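{- Let $\ell \neq 3$ be a prime and let $R_\ell = \operatorname{Res}(X^{2\ell}-1, (X-1)^{2\ell}-1)$. Then $\ell \nmid R_\ell$. In particular $R_\ell \neq 0$.
   Context: $\operatorname{Res}$ denotes the resultant of two polynomials in $\mathbb{Z}[X]$. -}

module Defs where

open import Data.Nat as ℕ using (ℕ; zero; suc)
open import Data.Integer as ℤ using (ℤ; +_; -[1+_]; 0ℤ; 1ℤ)
open import Data.List using (List; []; _∷_; length; map)
open import Data.Fin using (Fin; toℕ; punchIn)
import Data.Fin as Fin
open import Relation.Nullary using (does)
open import Data.Bool using (if_then_else_)

-- Polynomials in ℤ[X] as coefficient lists, lowest degree first.
Poly : Set
Poly = List ℤ

infixl 6 _+ₚ_ _-ₚ_
infixl 7 _*ₚ_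
infixr 8 _^ₚ_

_+ₚ_ : Poly → Poly → Poly
[] +ₚ q = q
(a ∷ p) +ₚ [] = a ∷ p
(a ∷ p) +ₚ (b ∷ q) = (a ℤ.+ b) ∷ (p +ₚ q)

negₚ : Poly → Poly
negₚ = map (λ x → ℤ.- x)

_-ₚ_ : Poly → Poly → Poly
p -ₚ q = p +ₚ negₚ q

_*ₚ_ : Poly → Poly → Poly
[] *ₚ q = []
(a ∷ p) *ₚ q = map (a ℤ.*_) q +ₚ (0ℤ ∷ (p *ₚ q))

constₚ : ℤ → Poly
constₚ c = c ∷ []

Xₚ : Poly
Xₚ = 0ℤ ∷ 1ℤ ∷ []

_^ₚ_ : Poly → ℕ → Poly
p ^ₚ zero = constₚ 1ℤ
p ^ₚ suc n = p *ₚ (p ^ₚ n)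

strip : Poly → Poly
strip [] = []
strip (a ∷ p) with strip p
... | [] = if does (a ℤ.≟ 0ℤ) then [] else (a ∷ [])
... | b ∷ q = a ∷ b ∷ q

coeff : Poly → ℤ → ℤ
coeff p -[1+ _ ] = 0ℤ
coeff [] (+ _) = 0ℤ
coeff (a ∷ p) (+ zero) = a
coeff (a ∷ p) (+ suc k) = coeff p (+ k)

Matrix : ℕ → Set
Matrix n = Fin n → Fin n → ℤ

minor : ∀ {n} → Matrix (suc n) → Fin (suc n) → Matrix n
minor M j r c = M (Fin.suc r) (punchIn j c)

sign : ℕ → ℤ
sign zero = 1ℤ
sign (suc zero) = ℤ.- 1ℤ
sign (suc (suc k)) = sign k

sumFin : ∀ n → (Fin n → ℤ) → ℤ
sumFin zero f = 0ℤ
sumFin (suc n) f = f Fin.zero ℤ.+ sumFin n (λ i → f (Fin.suc i))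

det : ∀ n → Matrix n → ℤ
det zero M = 1ℤ
det (suc n) M = sumFin (suc n) (λ j → sign (toℕ j) ℤ.* M Fin.zero j ℤ.* det n (minor M j))

-- Sylvester matrix of f (formal degree m) and g (formal degree n):
-- the first n rows hold the shifted coefficients of f (leading first),
-- the last m rows those of g.
sylvester : (m n : ℕ) → Poly → Poly → Matrix (m ℕ.+ n)
sylvester m n f g r c with toℕ r ℕ.<? n
... | Relation.Nullary.yes _ = coeff f ((+ m ℤ.+ + toℕ r) ℤ.- (+ toℕ c))
... | Relation.Nullary.no _  = coeff g ((+ n ℤ.+ + (toℕ r ℕ.∸ n)) ℤ.- (+ toℕ c))

-- Resultant of two polynomials in ℤ[X]: determinant of the Sylvester matrix
-- w.r.t. their actual degrees; by convention 0 if either polynomial is 0.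
Res : Poly → Poly → ℤ
Res f g = go (strip f) (strip g)
  where
  go : Poly → Poly → ℤ
  go [] _ = 0ℤ
  go (_ ∷ _) [] = 0ℤ
  go (a ∷ as) (b ∷ bs) =
    det (length as ℕ.+ length bs) (sylvester (length as) (length bs) (a ∷ as) (b ∷ bs))

R : ℕ → ℤ
R ℓ = Res (Xₚ ^ₚ (2 ℕ.* ℓ) -ₚ constₚ 1ℤ) ((Xₚ -ₚ constₚ 1ℤ) ^ₚ (2 ℕ.* ℓ) -ₚ constₚ 1ℤ)

-- Modulo ℓ, (X − 1)^ℓ ≡ X^ℓ + σ with σ = (−1)^ℓ, so (X − 1)^{2ℓ} − 1 ≡ X^{2ℓ} + 2σX^ℓ
-- coefficientwise, and R ℓ is congruent to the determinant of the Sylvester matrix of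
-- X^{2ℓ} − 1 and X^{2ℓ} + cX^ℓ with c = 2σ.  Adding column k − 2ℓ to column k, and then
-- −c times column k − ℓ to column k, makes that matrix block-triangular with determinant
-- (1 − c²)^ℓ = (−3)^ℓ.  Hence ℓ ∣ R ℓ would force ℓ ∣ 3.

module Submission where

open import Defs
open import Data.Nat using (ℕ)
open import Data.Nat.Primality using (Prime)
open import Data.Integer using (ℤ; +_; 0ℤ)
open import Data.Integer.Divisibility using (_∣_)
open import Data.Product using (_×_)
open import Relation.Nullary using (¬_)
open import Relation.Binary.PropositionalEquality using (_≡_; _≢_)

open import Algebra.Bundles using (AbelianGroup)
open import Level using (0ℓ)
open import Data.Empty using (⊥-elim)
open import Data.Fin as Fin using (Fin; toℕ; punchIn; punchOut; inject₁; fromℕ<)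
open import Data.Fin.Properties
  using ( toℕ-injective; suc-injective; punchIn-punchOut; punchOut-punchIn; punchOut-cong; punchInᵢ≢i
        ; toℕ-inject₁; toℕ-fromℕ<; toℕ<n )
open import Data.Integer using (-[1+_]; 1ℤ; _+_; _*_; -_; _-_; _^_)
import Data.Integer as ℤ
import Data.Integer.Properties as ℤP
import Data.Integer.Divisibility.Signed as Signed
open import Data.Integer.Tactic.RingSolver using (solve-∀)
open import Data.List using ([]; _∷_; length; map)
open import Data.Nat as ℕ using (zero; suc; _∸_; _!)
import Data.Nat.Properties as ℕP
import Data.Nat.Divisibility as ℕ∣
open import Data.Nat.Combinatorics using (_C_; nCk+nC[k+1]≡[n+1]C[k+1]; k>n⇒nCk≡0; nCn≡1; nCk≡n!/k![n-k]!; k![n∸k]!∣n!)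
open import Data.Nat.DivMod using (m/n*n≡m)
open import Data.Nat.Primality using (euclidsLemma; prime⇒nonZero; prime⇒nonTrivial; prime⇒irreducible; prime?)
open import Data.Product as Product using (∃; _,_)
open import Data.Sum as Sum using (_⊎_; inj₁; inj₂)
open import Function using (_∘_)
open import Relation.Nullary using (yes; no)
open import Relation.Nullary.Decidable using (from-yes)
open import Relation.Binary.Bundles using (Setoid)
open import Relation.Binary.Definitions using (tri<; tri≈; tri>)
open import Relation.Binary.PropositionalEquality using (refl; sym; trans; cong; cong₂; subst; module ≡-Reasoning)
import Relation.Binary.Reasoning.Setoid as ≈-Reasoning
open import Relation.Binary.Structures using (IsEquivalence)
open import Algebra.Properties.Group (AbelianGroup.group ℤP.+-0-abelianGroup) using (inverseʳ-unique)

-- Determinants: linearity and alternation in the columns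

sumFin-cong : ∀ n {f g : Fin n → ℤ} → (∀ i → f i ≡ g i) → sumFin n f ≡ sumFin n g
sumFin-cong zero    f≗g = refl
sumFin-cong (suc n) f≗g = cong₂ _+_ (f≗g Fin.zero) (sumFin-cong n (f≗g ∘ Fin.suc))

sumFin-+ : ∀ n (f g : Fin n → ℤ) → sumFin n (λ i → f i + g i) ≡ sumFin n f + sumFin n g
sumFin-+ zero    f g = refl
sumFin-+ (suc n) f g = trans (cong (_+_ (f Fin.zero + g Fin.zero)) (sumFin-+ n (f ∘ Fin.suc) (g ∘ Fin.suc)))
                             (interchange (f Fin.zero) (g Fin.zero) (sumFin n (f ∘ Fin.suc)) (sumFin n (g ∘ Fin.suc)))
  where
  interchange : ∀ a b c d → (a + b) + (c + d) ≡ (a + c) + (b + d)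
  interchange = solve-∀

sumFin-*ˡ : ∀ n c (f : Fin n → ℤ) → sumFin n (λ i → c * f i) ≡ c * sumFin n f
sumFin-*ˡ zero    c f = sym (ℤP.*-zeroʳ c)
sumFin-*ˡ (suc n) c f = trans (cong (_+_ (c * f Fin.zero)) (sumFin-*ˡ n c (f ∘ Fin.suc)))
                              (sym (ℤP.*-distribˡ-+ c _ _))

sumFin-single : ∀ n (f : Fin n → ℤ) a → (∀ i → i ≢ a → f i ≡ 0ℤ) → sumFin n f ≡ f a
sumFin-single (suc n) f Fin.zero f≡0 =
  trans (cong (_+_ (f Fin.zero)) (trans (sumFin-cong n (λ i → f≡0 (Fin.suc i) λ ())) (sumFin-zero n)))
        (ℤP.+-identityʳ _)
  where
  sumFin-zero : ∀ n → sumFin n (λ (_ : Fin n) → 0ℤ) ≡ 0ℤ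
  sumFin-zero zero    = refl
  sumFin-zero (suc n) = trans (ℤP.+-identityˡ _) (sumFin-zero n)
sumFin-single (suc n) f (Fin.suc a) f≡0 =
  trans (cong₂ _+_ (f≡0 Fin.zero λ ())
                   (sumFin-single n (f ∘ Fin.suc) a (λ i i≢a → f≡0 (Fin.suc i) (i≢a ∘ suc-injective))))
        (ℤP.+-identityˡ _)

sumFin-pair : ∀ n (f : Fin n → ℤ) a b → a ≢ b → (∀ i → i ≢ a → i ≢ b → f i ≡ 0ℤ) → sumFin n f ≡ f a + f b
sumFin-pair (suc n) f Fin.zero    Fin.zero    a≢b _   = ⊥-elim (a≢b refl)
sumFin-pair (suc n) f Fin.zero    (Fin.suc b) _   f≡0 =
  cong (_+_ (f Fin.zero)) (sumFin-single n (f ∘ Fin.suc) b (λ i i≢b → f≡0 (Fin.suc i) (λ ()) (i≢b ∘ suc-injective)))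
sumFin-pair (suc n) f (Fin.suc a) Fin.zero    _   f≡0 =
  trans (cong (_+_ (f Fin.zero)) (sumFin-single n (f ∘ Fin.suc) a (λ i i≢a → f≡0 (Fin.suc i) (i≢a ∘ suc-injective) (λ ()))))
        (ℤP.+-comm (f Fin.zero) (f (Fin.suc a)))
sumFin-pair (suc n) f (Fin.suc a) (Fin.suc b) a≢b f≡0 =
  trans (cong₂ _+_ (f≡0 Fin.zero (λ ()) (λ ()))
                   (sumFin-pair n (f ∘ Fin.suc) a b (a≢b ∘ cong Fin.suc)
                                (λ i i≢a i≢b → f≡0 (Fin.suc i) (i≢a ∘ suc-injective) (i≢b ∘ suc-injective))))
        (ℤP.+-identityˡ _)

sign-suc : ∀ k → sign (suc k) ≡ - sign k
sign-suc zero          = refl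
sign-suc (suc zero)    = refl
sign-suc (suc (suc k)) = sign-suc k

det-cong : ∀ n {M N : Matrix n} → (∀ r c → M r c ≡ N r c) → det n M ≡ det n N
det-cong zero    M≗N = refl
det-cong (suc n) M≗N = sumFin-cong (suc n) λ j →
  cong₂ (λ x y → sign (toℕ j) * x * y) (M≗N Fin.zero j) (det-cong n (λ r c → M≗N (Fin.suc r) (punchIn j c)))

laplaceTerm : ∀ {n} → Matrix (suc n) → Fin (suc n) → ℤ
laplaceTerm {n} M j = sign (toℕ j) * M Fin.zero j * det n (minor M j)

replaceCol : ∀ {n} → Fin n → (Fin n → ℤ) → Matrix n → Matrix n
replaceCol i v M r k with k Fin.≟ i
... | yes _ = v r
... | no  _ = M r k

replaceCol-here : ∀ {n} i v (M : Matrix n) r → replaceCol i v M r i ≡ v r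
replaceCol-here i v M r with i Fin.≟ i
... | yes _   = refl
... | no  i≢i = ⊥-elim (i≢i refl)

replaceCol-elsewhere : ∀ {n} i v (M : Matrix n) r {k} → k ≢ i → replaceCol i v M r k ≡ M r k
replaceCol-elsewhere i v M r {k} k≢i with k Fin.≟ i
... | yes k≡i = ⊥-elim (k≢i k≡i)
... | no  _   = refl

laplaceTerm-replaceCol-here : ∀ {n} (M : Matrix (suc n)) j v →
  laplaceTerm (replaceCol j v M) j ≡ sign (toℕ j) * v Fin.zero * det n (minor M j)
laplaceTerm-replaceCol-here {n} M j v =
  cong₂ (λ x y → sign (toℕ j) * x * y) (replaceCol-here j v M Fin.zero)
        (det-cong n λ r k → replaceCol-elsewhere j v M (Fin.suc r) (punchInᵢ≢i j k))

laplaceTerm-replaceCol-elsewhere : ∀ {n} (M : Matrix (suc n)) {i j} (j≢i : j ≢ i) v →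
  laplaceTerm (replaceCol i v M) j ≡ sign (toℕ j) * M Fin.zero j * det n (replaceCol (punchOut j≢i) (v ∘ Fin.suc) (minor M j))
laplaceTerm-replaceCol-elsewhere {n} M {i} {j} j≢i v =
  cong₂ (λ x y → sign (toℕ j) * x * y) (replaceCol-elsewhere i v M Fin.zero j≢i) (det-cong n minor-replaceCol)
  where
  minor-replaceCol : ∀ r k → minor (replaceCol i v M) j r k ≡ replaceCol (punchOut j≢i) (v ∘ Fin.suc) (minor M j) r k
  minor-replaceCol r k with punchIn j k Fin.≟ i | k Fin.≟ punchOut j≢i
  ... | yes _    | yes _    = refl
  ... | no  _    | no  _    = refl
  ... | yes jk≡i | no  k≢i′ = ⊥-elim (k≢i′ (trans (sym (punchOut-punchIn j)) (punchOut-cong j jk≡i)))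
  ... | no  jk≢i | yes k≡i′ = ⊥-elim (jk≢i (trans (cong (punchIn j) k≡i′) (punchIn-punchOut j≢i)))

det-linear : ∀ n (M : Matrix n) i (u w : Fin n → ℤ) c →
  det n (replaceCol i (λ r → u r + c * w r) M) ≡ det n (replaceCol i u M) + c * det n (replaceCol i w M)
det-linear (suc n) M i u w c = begin
  sumFin (suc n) (laplaceTerm (replaceCol i u+cw M))
    ≡⟨ sumFin-cong (suc n) termwise ⟩
  sumFin (suc n) (λ j → laplaceTerm (replaceCol i u M) j + c * laplaceTerm (replaceCol i w M) j)
    ≡⟨ sumFin-+ (suc n) (laplaceTerm (replaceCol i u M)) (λ j → c * laplaceTerm (replaceCol i w M) j) ⟩
  sumFin (suc n) (laplaceTerm (replaceCol i u M)) + sumFin (suc n) (λ j → c * laplaceTerm (replaceCol i w M) j)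
    ≡⟨ cong (_+_ (sumFin (suc n) (laplaceTerm (replaceCol i u M)))) (sumFin-*ˡ (suc n) c (laplaceTerm (replaceCol i w M))) ⟩
  sumFin (suc n) (laplaceTerm (replaceCol i u M)) + c * sumFin (suc n) (laplaceTerm (replaceCol i w M))
    ∎
  where
  open ≡-Reasoning
  u+cw : Fin (suc n) → ℤ
  u+cw r = u r + c * w r
  here : ∀ s a b D c → s * (a + c * b) * D ≡ s * a * D + c * (s * b * D)
  here = solve-∀
  elsewhere : ∀ s m Du Dw c → s * m * (Du + c * Dw) ≡ s * m * Du + c * (s * m * Dw)
  elsewhere = solve-∀
  termwise : ∀ j → laplaceTerm (replaceCol i u+cw M) j ≡ laplaceTerm (replaceCol i u M) j + c * laplaceTerm (replaceCol i w M) j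
  termwise j with i Fin.≟ j
  ... | yes refl = begin
    laplaceTerm (replaceCol j u+cw M) j
      ≡⟨ laplaceTerm-replaceCol-here M j u+cw ⟩
    sign (toℕ j) * u+cw Fin.zero * det n (minor M j)
      ≡⟨ here (sign (toℕ j)) (u Fin.zero) (w Fin.zero) (det n (minor M j)) c ⟩
    sign (toℕ j) * u Fin.zero * det n (minor M j) + c * (sign (toℕ j) * w Fin.zero * det n (minor M j))
      ≡⟨ sym (cong₂ (λ x y → x + c * y) (laplaceTerm-replaceCol-here M j u) (laplaceTerm-replaceCol-here M j w)) ⟩
    laplaceTerm (replaceCol j u M) j + c * laplaceTerm (replaceCol j w M) j
      ∎
  ... | no i≢j = begin
    laplaceTerm (replaceCol i u+cw M) j
      ≡⟨ laplaceTerm-replaceCol-elsewhere M j≢i u+cw ⟩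
    s * m * det n (replaceCol i′ (u+cw ∘ Fin.suc) (minor M j))
      ≡⟨ cong (s * m *_) (det-linear n (minor M j) i′ (u ∘ Fin.suc) (w ∘ Fin.suc) c) ⟩
    s * m * (det n (replaceCol i′ (u ∘ Fin.suc) (minor M j)) + c * det n (replaceCol i′ (w ∘ Fin.suc) (minor M j)))
      ≡⟨ elsewhere s m _ _ c ⟩
    s * m * det n (replaceCol i′ (u ∘ Fin.suc) (minor M j)) + c * (s * m * det n (replaceCol i′ (w ∘ Fin.suc) (minor M j)))
      ≡⟨ sym (cong₂ (λ x y → x + c * y) (laplaceTerm-replaceCol-elsewhere M j≢i u)
                                        (laplaceTerm-replaceCol-elsewhere M j≢i w)) ⟩
    laplaceTerm (replaceCol i u M) j + c * laplaceTerm (replaceCol i w M) j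
      ∎
    where
    s m : ℤ
    s = sign (toℕ j)
    m = M Fin.zero j
    j≢i : j ≢ i
    j≢i = i≢j ∘ sym
    i′ : Fin n
    i′ = punchOut j≢i

punchIn-adjacent : ∀ {n} (a b : Fin (suc n)) (k : Fin n) → toℕ b ≡ suc (toℕ a) →
                   punchIn a k ≡ punchIn b k ⊎ (punchIn a k ≡ b × punchIn b k ≡ a)
punchIn-adjacent Fin.zero    Fin.zero              k           ()
punchIn-adjacent Fin.zero    (Fin.suc Fin.zero)    Fin.zero    _ = inj₂ (refl , refl)
punchIn-adjacent Fin.zero    (Fin.suc Fin.zero)    (Fin.suc k) _ = inj₁ refl
punchIn-adjacent Fin.zero    (Fin.suc (Fin.suc b)) k           ()
punchIn-adjacent (Fin.suc a) Fin.zero              k           ()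
punchIn-adjacent (Fin.suc a) (Fin.suc b)           Fin.zero    _ = inj₁ refl
punchIn-adjacent (Fin.suc a) (Fin.suc b)           (Fin.suc k) b≡a+1 =
  Sum.map (cong Fin.suc) (Product.map (cong Fin.suc) (cong Fin.suc)) (punchIn-adjacent a b k (ℕP.suc-injective b≡a+1))

punchOut-adjacent : ∀ {n} {j a b : Fin (suc n)} (j≢a : j ≢ a) (j≢b : j ≢ b) →
                    toℕ b ≡ suc (toℕ a) → toℕ (punchOut j≢b) ≡ suc (toℕ (punchOut j≢a))
punchOut-adjacent {_}           {Fin.zero}            {Fin.zero}  {_}                   j≢a _   _ = ⊥-elim (j≢a refl)
punchOut-adjacent {_}           {Fin.zero}            {Fin.suc a} {Fin.zero}            _   _   ()
punchOut-adjacent {_}           {Fin.zero}            {Fin.suc a} {Fin.suc b}           _   _   b≡a+1 = ℕP.suc-injective b≡a+1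
punchOut-adjacent {zero}        {Fin.suc ()}
punchOut-adjacent {suc n}       {Fin.suc j}           {Fin.zero}  {Fin.zero}            _   _   ()
punchOut-adjacent {suc n}       {Fin.suc Fin.zero}    {Fin.zero}  {Fin.suc Fin.zero}    _   j≢b _ = ⊥-elim (j≢b refl)
punchOut-adjacent {suc zero}    {Fin.suc (Fin.suc ())}
punchOut-adjacent {suc (suc n)} {Fin.suc (Fin.suc j)} {Fin.zero}  {Fin.suc Fin.zero}    _   _   _ = refl
punchOut-adjacent {suc n}       {Fin.suc j}           {Fin.zero}  {Fin.suc (Fin.suc b)} _   _   ()
punchOut-adjacent {suc n}       {Fin.suc j}           {Fin.suc a} {Fin.zero}            _   _   ()
punchOut-adjacent {suc n}       {Fin.suc j}           {Fin.suc a} {Fin.suc b}           j≢a j≢b b≡a+1 =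
  cong suc (punchOut-adjacent (j≢a ∘ cong Fin.suc) (j≢b ∘ cong Fin.suc) (ℕP.suc-injective b≡a+1))

-- Every minor except those at a and b still has two adjacent equal columns; those two
-- minors coincide while their signs are opposite.
det-adjacentEqualCols : ∀ n (M : Matrix n) a b → toℕ b ≡ suc (toℕ a) → (∀ r → M r a ≡ M r b) → det n M ≡ 0ℤ
det-adjacentEqualCols (suc n) M a b b≡a+1 Ma≡Mb =
  trans (sumFin-pair (suc n) (laplaceTerm M) a b a≢b vanish) cancel
  where
  a≢b : a ≢ b
  a≢b refl = ℕP.1+n≢n (sym b≡a+1)
  vanish : ∀ j → j ≢ a → j ≢ b → laplaceTerm M j ≡ 0ℤ
  vanish j j≢a j≢b = trans (cong (sign (toℕ j) * M Fin.zero j *_) minor≡0) (ℤP.*-zeroʳ (sign (toℕ j) * M Fin.zero j))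
    where
    minor≡0 : det n (minor M j) ≡ 0ℤ
    minor≡0 = det-adjacentEqualCols n (minor M j) (punchOut j≢a) (punchOut j≢b) (punchOut-adjacent j≢a j≢b b≡a+1)
      λ r → trans (cong (M (Fin.suc r)) (punchIn-punchOut j≢a))
                  (trans (Ma≡Mb (Fin.suc r)) (cong (M (Fin.suc r)) (sym (punchIn-punchOut j≢b))))
  minors : ∀ r k → minor M a r k ≡ minor M b r k
  minors r k with punchIn-adjacent a b k b≡a+1
  ... | inj₁ same            = cong (M (Fin.suc r)) same
  ... | inj₂ (a↦b , b↦a) = trans (cong (M (Fin.suc r)) a↦b)
                                  (trans (sym (Ma≡Mb (Fin.suc r))) (cong (M (Fin.suc r)) (sym b↦a)))
  opposite : ∀ s m D → s * m * D + (- s) * m * D ≡ 0ℤ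
  opposite = solve-∀
  cancel : laplaceTerm M a + laplaceTerm M b ≡ 0ℤ
  cancel = begin
    sign (toℕ a) * M Fin.zero a * det n (minor M a) + sign (toℕ b) * M Fin.zero b * det n (minor M b)
      ≡⟨ cong₂ (λ s D → sign (toℕ a) * M Fin.zero a * det n (minor M a) + s * D)
               (cong₂ _*_ (trans (cong sign b≡a+1) (sign-suc (toℕ a))) (sym (Ma≡Mb Fin.zero)))
               (sym (det-cong n minors)) ⟩
    sign (toℕ a) * M Fin.zero a * det n (minor M a) + (- sign (toℕ a)) * M Fin.zero a * det n (minor M a)
      ≡⟨ opposite (sign (toℕ a)) (M Fin.zero a) (det n (minor M a)) ⟩
    0ℤ ∎
    where open ≡-Reasoning

replaceCol-comm : ∀ {n} {a b : Fin n} → a ≢ b → ∀ x y (M : Matrix n) r k →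
                  replaceCol a x (replaceCol b y M) r k ≡ replaceCol b y (replaceCol a x M) r k
replaceCol-comm {a = a} {b} a≢b x y M r k with k Fin.≟ a | k Fin.≟ b
... | yes refl | yes refl = ⊥-elim (a≢b refl)
... | yes refl | no  _    = sym (replaceCol-here k x M r)
... | no  _    | yes refl = replaceCol-here k y M r
... | no  k≢a  | no  k≢b  = trans (replaceCol-elsewhere b y M r k≢b) (sym (replaceCol-elsewhere a x M r k≢a))

replaceCol-id : ∀ {n} i v (M : Matrix n) → (∀ r → v r ≡ M r i) → ∀ r k → replaceCol i v M r k ≡ M r k
replaceCol-id i v M v≡Mi r k with k Fin.≟ i
... | yes refl = v≡Mi r
... | no  _    = refl

swapCols : ∀ {n} → Fin n → Fin n → Matrix n → Matrix n
swapCols a b M = replaceCol a (λ r → M r b) (replaceCol b (λ r → M r a) M)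

-- Expand the vanishing determinant with both columns a and b replaced by their sum.
det-swapAdjacentCols : ∀ n (M : Matrix n) a b → toℕ b ≡ suc (toℕ a) → det n (swapCols a b M) ≡ - det n M
det-swapAdjacentCols n M a b b≡a+1 = inverseʳ-unique (det n M) (det n (swapCols a b M)) (begin
  det n M + det n (swapCols a b M)
    ≡⟨ cong (_+_ (det n M)) (sym (ℤP.*-identityˡ _)) ⟩
  det n M + 1ℤ * det n (swapCols a b M)
    ≡⟨ sym (cong₂ (λ x y → x + 1ℤ * y) expand-U expand-V) ⟩
  det n (rc a U (rc b W M)) + 1ℤ * det n (rc a V (rc b W M))
    ≡⟨ sym (det-linear n (rc b W M) a U V 1ℤ) ⟩
  det n (rc a W (rc b W M))
    ≡⟨ det-bothCols W M ⟩
  0ℤ ∎)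
  where
  open ≡-Reasoning
  rc : Fin n → (Fin n → ℤ) → Matrix n → Matrix n
  rc = replaceCol
  U V W : Fin n → ℤ
  U r = M r a
  V r = M r b
  W r = U r + 1ℤ * V r
  a≢b : a ≢ b
  a≢b refl = ℕP.1+n≢n (sym b≡a+1)
  b≢a : b ≢ a
  b≢a = a≢b ∘ sym
  det-bothCols : ∀ x N → det n (rc a x (rc b x N)) ≡ 0ℤ
  det-bothCols x N = det-adjacentEqualCols n _ a b b≡a+1 λ r →
    trans (replaceCol-here a x _ r) (sym (trans (replaceCol-elsewhere a x _ r b≢a) (replaceCol-here b x N r)))
  det-bothCols′ : ∀ x N → det n (rc b x (rc a x N)) ≡ 0ℤ
  det-bothCols′ x N = trans (det-cong n (λ r k → sym (replaceCol-comm a≢b x x N r k))) (det-bothCols x N)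
  expand : ∀ x → det n (rc a x (rc b W M)) ≡ det n (rc b U (rc a x M)) + 1ℤ * det n (rc b V (rc a x M))
  expand x = trans (det-cong n (replaceCol-comm a≢b x W M)) (det-linear n (rc a x M) b U V 1ℤ)
  expand-U : det n (rc a U (rc b W M)) ≡ det n M
  expand-U = begin
    det n (rc a U (rc b W M))
      ≡⟨ expand U ⟩
    det n (rc b U (rc a U M)) + 1ℤ * det n (rc b V (rc a U M))
      ≡⟨ cong₂ (λ x y → x + 1ℤ * y) (det-bothCols′ U M) (det-cong n restore) ⟩
    0ℤ + 1ℤ * det n M
      ≡⟨ trans (ℤP.+-identityˡ _) (ℤP.*-identityˡ (det n M)) ⟩
    det n M ∎
    where
    restore : ∀ r k → rc b V (rc a U M) r k ≡ M r k
    restore r k = trans (replaceCol-id b V _ (λ r → sym (replaceCol-elsewhere a U M r b≢a)) r k)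
                        (replaceCol-id a U M (λ _ → refl) r k)
  expand-V : det n (rc a V (rc b W M)) ≡ det n (swapCols a b M)
  expand-V = begin
    det n (rc a V (rc b W M))
      ≡⟨ expand V ⟩
    det n (rc b U (rc a V M)) + 1ℤ * det n (rc b V (rc a V M))
      ≡⟨ cong (λ x → det n (rc b U (rc a V M)) + 1ℤ * x) (det-bothCols′ V M) ⟩
    det n (rc b U (rc a V M)) + 1ℤ * 0ℤ
      ≡⟨ ℤP.+-identityʳ _ ⟩
    det n (rc b U (rc a V M))
      ≡⟨ det-cong n (λ r k → sym (replaceCol-comm a≢b V U M r k)) ⟩
    det n (swapCols a b M) ∎

det-equalColsAtDistance : ∀ d n (M : Matrix n) a b → toℕ b ≡ suc (toℕ a ℕ.+ d) →
                          (∀ r → M r a ≡ M r b) → det n M ≡ 0ℤ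
det-equalColsAtDistance zero    n       M a b           b≡a+1 Ma≡Mb =
  det-adjacentEqualCols n M a b (trans b≡a+1 (cong suc (ℕP.+-identityʳ (toℕ a)))) Ma≡Mb
det-equalColsAtDistance (suc d) (suc n) M a Fin.zero    ()    Ma≡Mb
det-equalColsAtDistance (suc d) (suc n) M a (Fin.suc c) b≡a+d Ma≡Mb = ℤP.neg-injective (begin
  - det (suc n) M
    ≡⟨ sym (det-swapAdjacentCols (suc n) M c′ (Fin.suc c) (cong suc (sym (toℕ-inject₁ c)))) ⟩
  det (suc n) (swapCols c′ (Fin.suc c) M)
    ≡⟨ det-equalColsAtDistance d (suc n) (swapCols c′ (Fin.suc c) M) a c′ c′≡a+d equal ⟩
  0ℤ ∎)
  where
  open ≡-Reasoning
  c′ : Fin (suc n)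
  c′ = inject₁ c
  c′≡a+d : toℕ c′ ≡ suc (toℕ a ℕ.+ d)
  c′≡a+d = trans (toℕ-inject₁ c) (trans (ℕP.suc-injective b≡a+d) (ℕP.+-suc (toℕ a) d))
  apart : ∀ {m} {a b : Fin m} {e} → toℕ b ≡ suc (toℕ a ℕ.+ e) → a ≢ b
  apart {a = a} b≡a+e refl = ℕP.m≢1+m+n (toℕ a) b≡a+e
  col-b col-c′ : Fin (suc n) → ℤ
  col-b  r = M r (Fin.suc c)
  col-c′ r = M r c′
  equal : ∀ r → swapCols c′ (Fin.suc c) M r a ≡ swapCols c′ (Fin.suc c) M r c′
  equal r = begin
    swapCols c′ (Fin.suc c) M r a       ≡⟨ replaceCol-elsewhere c′ col-b _ r {a} (apart c′≡a+d) ⟩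
    replaceCol (Fin.suc c) col-c′ M r a ≡⟨ replaceCol-elsewhere (Fin.suc c) col-c′ M r {a} (apart b≡a+d) ⟩
    M r a                               ≡⟨ Ma≡Mb r ⟩
    M r (Fin.suc c)                     ≡⟨ sym (replaceCol-here c′ col-b (replaceCol (Fin.suc c) col-c′ M) r) ⟩
    swapCols c′ (Fin.suc c) M r c′      ∎

det-equalCols : ∀ n (M : Matrix n) {a b} → a ≢ b → (∀ r → M r a ≡ M r b) → det n M ≡ 0ℤ
det-equalCols n M {a} {b} a≢b Ma≡Mb with ℕ.<-cmp (toℕ a) (toℕ b)
... | tri< a<b _ _ = let d , a+1+d≡b = ℕP.m≤n⇒∃[o]m+o≡n a<b in
  det-equalColsAtDistance d n M a b (sym a+1+d≡b) Ma≡Mb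
... | tri≈ _ a≡b _ = ⊥-elim (a≢b (toℕ-injective a≡b))
... | tri> _ _ b<a = let d , b+1+d≡a = ℕP.m≤n⇒∃[o]m+o≡n b<a in
  det-equalColsAtDistance d n M b a (sym b+1+d≡a) (sym ∘ Ma≡Mb)

det-addCol : ∀ n (M : Matrix n) {i j} → i ≢ j → ∀ c → det n (replaceCol i (λ r → M r i + c * M r j) M) ≡ det n M
det-addCol n M {i} {j} i≢j c = begin
  det n (replaceCol i (λ r → M r i + c * M r j) M)
    ≡⟨ det-linear n M i (λ r → M r i) (λ r → M r j) c ⟩
  det n (replaceCol i (λ r → M r i) M) + c * det n (replaceCol i (λ r → M r j) M)
    ≡⟨ cong₂ (λ x y → x + c * y) (det-cong n (replaceCol-id i _ M λ _ → refl)) (det-equalCols n _ i≢j equal) ⟩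
  det n M + c * 0ℤ
    ≡⟨ trans (cong (_+_ (det n M)) (ℤP.*-zeroʳ c)) (ℤP.+-identityʳ _) ⟩
  det n M ∎
  where
  open ≡-Reasoning
  equal : ∀ r → replaceCol i (λ r → M r j) M r i ≡ replaceCol i (λ r → M r j) M r j
  equal r = trans (replaceCol-here i _ M r) (sym (replaceCol-elsewhere i _ M r (i≢j ∘ sym)))

matrix : ∀ {n} → (ℕ → ℕ → ℤ) → Matrix n
matrix F r k = F (toℕ r) (toℕ k)

det-congᴺ : ∀ n {F G : ℕ → ℕ → ℤ} → (∀ r k → r ℕ.< n → k ℕ.< n → F r k ≡ G r k) →
            det n (matrix F) ≡ det n (matrix G)
det-congᴺ n F≡G = det-cong n λ r k → F≡G (toℕ r) (toℕ k) (toℕ<n r) (toℕ<n k)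

δ : ℕ → ℕ → ℤ
δ a b with a ℕ.≟ b
... | yes _ = 1ℤ
... | no  _ = 0ℤ

δ-refl : ∀ a → δ a a ≡ 1ℤ
δ-refl a with a ℕ.≟ a
... | yes _   = refl
... | no  a≢a = ⊥-elim (a≢a refl)

δ-≢ : ∀ {a b} → a ≢ b → δ a b ≡ 0ℤ
δ-≢ {a} {b} a≢b with a ℕ.≟ b
... | yes a≡b = ⊥-elim (a≢b a≡b)
... | no  _   = refl

δ-< : ∀ {a b} → a ℕ.< b → δ a b ≡ 0ℤ
δ-< = δ-≢ ∘ ℕP.<⇒≢

δ-> : ∀ {a b} → b ℕ.< a → δ a b ≡ 0ℤ
δ-> = δ-≢ ∘ ℕP.>⇒≢

δ-<+ : ∀ {a m} b → a ℕ.< m → δ a (m ℕ.+ b) ≡ 0ℤ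
δ-<+ {m = m} b a<m = δ-< (ℕP.<-≤-trans a<m (ℕP.m≤m+n m b))

δ-+< : ∀ {a m} b → a ℕ.< m → δ (m ℕ.+ b) a ≡ 0ℤ
δ-+< {m = m} b a<m = δ-> (ℕP.<-≤-trans a<m (ℕP.m≤m+n m b))

δ-+ˡ : ∀ m a b → δ (m ℕ.+ a) (m ℕ.+ b) ≡ δ a b
δ-+ˡ m a b with a ℕ.≟ b
... | yes refl = δ-refl (m ℕ.+ a)
... | no  a≢b  = δ-≢ (a≢b ∘ ℕP.+-cancelˡ-≡ m a b)

det-firstRow-single : ∀ n (M : Matrix (suc n)) → (∀ j → j ≢ Fin.zero → M Fin.zero j ≡ 0ℤ) →
                   det (suc n) M ≡ M Fin.zero Fin.zero * det n (minor M Fin.zero)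
det-firstRow-single n M row≡0 =
  trans (sumFin-single (suc n) (laplaceTerm M) Fin.zero vanish)
        (cong (_* det n (minor M Fin.zero)) (ℤP.*-identityˡ (M Fin.zero Fin.zero)))
  where
  vanish : ∀ j → j ≢ Fin.zero → laplaceTerm M j ≡ 0ℤ
  vanish j j≢0 = begin
    sign (toℕ j) * M Fin.zero j * det n (minor M j) ≡⟨ cong (λ m → sign (toℕ j) * m * det n (minor M j)) (row≡0 j j≢0) ⟩
    sign (toℕ j) * 0ℤ * det n (minor M j)           ≡⟨ cong (_* det n (minor M j)) (ℤP.*-zeroʳ (sign (toℕ j))) ⟩
    0ℤ * det n (minor M j)                          ≡⟨ ℤP.*-zeroˡ (det n (minor M j)) ⟩
    0ℤ                                              ∎
    where open ≡-Reasoning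

det-scalarBlock : ∀ a b x (F : ℕ → ℕ → ℤ) → (∀ r k → r ℕ.< a → k ℕ.< a ℕ.+ b → F r k ≡ x * δ r k) →
                  det (a ℕ.+ b) (matrix F) ≡ x ^ a * det b (matrix (λ r k → F (a ℕ.+ r) (a ℕ.+ k)))
det-scalarBlock zero    b x F _        = sym (ℤP.*-identityˡ _)
det-scalarBlock (suc a) b x F topRows = begin
  det (suc a ℕ.+ b) (matrix F)
    ≡⟨ det-firstRow-single (a ℕ.+ b) (matrix F) row≡0 ⟩
  F 0 0 * det (a ℕ.+ b) (matrix (λ r k → F (suc r) (suc k)))
    ≡⟨ cong₂ _*_ corner (det-scalarBlock a b x (λ r k → F (suc r) (suc k)) topRows′) ⟩
  x * (x ^ a * det b (matrix (λ r k → F (suc a ℕ.+ r) (suc a ℕ.+ k))))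
    ≡⟨ sym (ℤP.*-assoc x (x ^ a) _) ⟩
  x ^ suc a * det b (matrix (λ r k → F (suc a ℕ.+ r) (suc a ℕ.+ k))) ∎
  where
  open ≡-Reasoning
  row≡0 : ∀ j → j ≢ Fin.zero → F 0 (toℕ j) ≡ 0ℤ
  row≡0 j j≢0 = trans (topRows 0 (toℕ j) (ℕ.s≤s ℕ.z≤n) (toℕ<n j))
                      (trans (cong (x *_) (δ-≢ λ 0≡j → j≢0 (toℕ-injective (sym 0≡j)))) (ℤP.*-zeroʳ x))
  corner : F 0 0 ≡ x
  corner = trans (topRows 0 0 (ℕ.s≤s ℕ.z≤n) (ℕ.s≤s ℕ.z≤n)) (ℤP.*-identityʳ x)
  topRows′ : ∀ r k → r ℕ.< a → k ℕ.< a ℕ.+ b → F (suc r) (suc k) ≡ x * δ r k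
  topRows′ r k r<a k<a+b = trans (topRows (suc r) (suc k) (ℕ.s≤s r<a) (ℕ.s≤s k<a+b)) (cong (x *_) (δ-+ˡ 1 r k))

<⊎≡+ : ∀ d k → k ℕ.< d ⊎ ∃ λ t → k ≡ d ℕ.+ t
<⊎≡+ d k with k ℕ.<? d
... | yes k<d = inj₁ k<d
... | no  k≮d = inj₂ (k ∸ d , sym (ℕP.m+[n∸m]≡n (ℕP.≮⇒≥ k≮d)))

-- shear d c s F adds c times column t to column d + t, for every t < s.
shear : ℕ → ℤ → ℕ → (ℕ → ℕ → ℤ) → ℕ → ℕ → ℤ
shear d c zero    F = F
shear d c (suc s) F r k with k ℕ.≟ d ℕ.+ s
... | yes _ = shear d c s F r k + c * shear d c s F r s
... | no  _ = shear d c s F r k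

shear-low : ∀ d c s F r {k} → k ℕ.< d → shear d c s F r k ≡ F r k
shear-low d c zero    F r k<d = refl
shear-low d c (suc s) F r {k} k<d with k ℕ.≟ d ℕ.+ s
... | yes refl = ⊥-elim (ℕP.m+n≮m d s k<d)
... | no  _    = shear-low d c s F r k<d

shear-untouched : ∀ d c s F r {t} → s ℕ.≤ t → shear d c s F r (d ℕ.+ t) ≡ F r (d ℕ.+ t)
shear-untouched d c zero    F r s≤t = refl
shear-untouched d c (suc s) F r {t} s<t with d ℕ.+ t ℕ.≟ d ℕ.+ s
... | yes d+t≡d+s = ⊥-elim (ℕP.<⇒≢ s<t (sym (ℕP.+-cancelˡ-≡ d t s d+t≡d+s)))
... | no  _       = shear-untouched d c s F r (ℕP.<⇒≤ s<t)

shear-high : ∀ d c s F r {t} → t ℕ.< s → s ℕ.≤ d → shear d c s F r (d ℕ.+ t) ≡ F r (d ℕ.+ t) + c * F r t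
shear-high d c (suc s) F r {t} t<s+1 s<d with d ℕ.+ t ℕ.≟ d ℕ.+ s
... | yes d+t≡d+s rewrite ℕP.+-cancelˡ-≡ d t s d+t≡d+s =
  cong₂ (λ x y → x + c * y) (shear-untouched d c s F r ℕP.≤-refl) (shear-low d c s F r s<d)
... | no  d+t≢d+s =
  shear-high d c s F r (ℕP.≤∧≢⇒< (ℕP.≤-pred t<s+1) (d+t≢d+s ∘ cong (d ℕ.+_))) (ℕP.<⇒≤ s<d)

det-shear : ∀ d c s F → s ℕ.≤ d → det (d ℕ.+ d) (matrix (shear d c s F)) ≡ det (d ℕ.+ d) (matrix F)
det-shear d c zero    F _   = refl
det-shear d c (suc s) F s<d = begin
  det (d ℕ.+ d) (matrix (shear d c (suc s) F))
    ≡⟨ det-cong (d ℕ.+ d) step ⟩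
  det (d ℕ.+ d) (replaceCol i (λ r → G r i + c * G r j) G)
    ≡⟨ det-addCol (d ℕ.+ d) G i≢j c ⟩
  det (d ℕ.+ d) G
    ≡⟨ det-shear d c s F (ℕP.<⇒≤ s<d) ⟩
  det (d ℕ.+ d) (matrix F) ∎
  where
  open ≡-Reasoning
  G : Matrix (d ℕ.+ d)
  G = matrix (shear d c s F)
  i j : Fin (d ℕ.+ d)
  i = fromℕ< (ℕP.+-monoʳ-< d s<d)
  j = fromℕ< (ℕP.<-≤-trans s<d (ℕP.m≤m+n d d))
  toℕi : toℕ i ≡ d ℕ.+ s
  toℕi = toℕ-fromℕ< _
  toℕj : toℕ j ≡ s
  toℕj = toℕ-fromℕ< _
  i≢j : i ≢ j
  i≢j i≡j = ℕP.m+n≮m d s (subst (ℕ._< d) (sym (trans (sym toℕi) (trans (cong toℕ i≡j) toℕj))) s<d)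
  step : ∀ r k → matrix (shear d c (suc s) F) r k ≡ replaceCol i (λ r → G r i + c * G r j) G r k
  step r k with toℕ k ℕ.≟ d ℕ.+ s | k Fin.≟ i
  ... | yes _      | yes refl = cong (λ t → shear d c s F (toℕ r) (toℕ k) + c * shear d c s F (toℕ r) t) (sym toℕj)
  ... | no  _      | no  _    = refl
  ... | yes k≡d+s  | no  k≢i  = ⊥-elim (k≢i (toℕ-injective (trans k≡d+s (sym toℕi))))
  ... | no  k≢d+s  | yes refl = ⊥-elim (k≢d+s toℕi)

det-scalar : ∀ n x → det n (matrix (λ r k → x * δ r k)) ≡ x ^ n
det-scalar n x = begin
  det n (matrix (λ r k → x * δ r k))
    ≡⟨ cong (λ m → det m (matrix (λ r k → x * δ r k))) (sym (ℕP.+-identityʳ n)) ⟩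
  det (n ℕ.+ 0) (matrix (λ r k → x * δ r k))
    ≡⟨ det-scalarBlock n 0 x (λ r k → x * δ r k) (λ _ _ _ _ → refl) ⟩
  x ^ n * 1ℤ
    ≡⟨ ℤP.*-identityʳ (x ^ n) ⟩
  x ^ n ∎
  where open ≡-Reasoning

det-identityBlock : ∀ a b (F : ℕ → ℕ → ℤ) → (∀ r k → r ℕ.< a → k ℕ.< a ℕ.+ b → F r k ≡ δ r k) →
                    det (a ℕ.+ b) (matrix F) ≡ det b (matrix (λ r k → F (a ℕ.+ r) (a ℕ.+ k)))
det-identityBlock a b F topRows = begin
  det (a ℕ.+ b) (matrix F)
    ≡⟨ det-scalarBlock a b 1ℤ F (λ r k r<a k<a+b → trans (topRows r k r<a k<a+b) (sym (ℤP.*-identityˡ (δ r k)))) ⟩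
  1ℤ ^ a * det b (matrix (λ r k → F (a ℕ.+ r) (a ℕ.+ k)))
    ≡⟨ trans (cong (_* det b (matrix (λ r k → F (a ℕ.+ r) (a ℕ.+ k)))) (ℤP.^-zeroˡ a)) (ℤP.*-identityˡ _) ⟩
  det b (matrix (λ r k → F (a ℕ.+ r) (a ℕ.+ k))) ∎
  where open ≡-Reasoning

-- Coefficients of polynomials

monomial : ℕ → ℤ → ℤ
monomial m z with z ℤ.≟ + m
... | yes _ = 1ℤ
... | no  _ = 0ℤ

monomial-+ : ∀ m k → monomial m (+ k) ≡ δ k m
monomial-+ m k with + k ℤ.≟ + m | k ℕ.≟ m
... | yes _   | yes _   = refl
... | no  _   | no  _   = refl
... | yes k≡m | no  k≢m = ⊥-elim (k≢m (ℤP.+-injective k≡m))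
... | no  k≢m | yes k≡m = ⊥-elim (k≢m (cong +_ k≡m))

monomial-- : ∀ m a z → monomial m (z - + a) ≡ monomial (m ℕ.+ a) z
monomial-- m a z with z - + a ℤ.≟ + m | z ℤ.≟ + (m ℕ.+ a)
... | yes _ | yes _ = refl
... | no  _ | no  _ = refl
... | yes z-a≡m | no  z≢m+a = ⊥-elim (z≢m+a (begin
  z             ≡⟨ sym (sub-add z (+ a)) ⟩
  z - + a + + a ≡⟨ cong (_+ + a) z-a≡m ⟩
  + m + + a     ≡⟨ sym (ℤP.pos-+ m a) ⟩
  + (m ℕ.+ a)   ∎))
  where
  open ≡-Reasoning
  sub-add : ∀ x y → x - y + y ≡ x
  sub-add = solve-∀
... | no  z-a≢m | yes refl = ⊥-elim (z-a≢m (trans (cong (_- + a) (ℤP.pos-+ m a)) (add-sub (+ m) (+ a))))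
  where
  add-sub : ∀ x y → x + y - y ≡ x
  add-sub = solve-∀

monomial-+- : ∀ m a k → monomial m (+ a - + k) ≡ δ a (m ℕ.+ k)
monomial-+- m a k = trans (monomial-- m k (+ a)) (monomial-+ (m ℕ.+ k) a)

coeff-[] : ∀ z → coeff [] z ≡ 0ℤ
coeff-[] -[1+ _ ] = refl
coeff-[] (+ _)    = refl

coeff-+ₚ : ∀ f g z → coeff (f +ₚ g) z ≡ coeff f z + coeff g z
coeff-+ₚ []      g       z          = sym (trans (cong (_+ coeff g z) (coeff-[] z)) (ℤP.+-identityˡ _))
coeff-+ₚ (a ∷ f) []      z          = sym (trans (cong (_+_ (coeff (a ∷ f) z)) (coeff-[] z)) (ℤP.+-identityʳ _))
coeff-+ₚ (a ∷ f) (b ∷ g) -[1+ _ ]   = refl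
coeff-+ₚ (a ∷ f) (b ∷ g) (+ zero)   = refl
coeff-+ₚ (a ∷ f) (b ∷ g) (+ suc k) = coeff-+ₚ f g (+ k)

coeff-map : ∀ (φ : ℤ → ℤ) → φ 0ℤ ≡ 0ℤ → ∀ f z → coeff (map φ f) z ≡ φ (coeff f z)
coeff-map φ φ0≡0 []      z          = trans (coeff-[] z) (sym (trans (cong φ (coeff-[] z)) φ0≡0))
coeff-map φ φ0≡0 (a ∷ f) -[1+ _ ]   = sym φ0≡0
coeff-map φ φ0≡0 (a ∷ f) (+ zero)   = refl
coeff-map φ φ0≡0 (a ∷ f) (+ suc k) = coeff-map φ φ0≡0 f (+ k)

coeff-X* : ∀ f z → coeff (0ℤ ∷ f) z ≡ coeff f (z - 1ℤ)
coeff-X* f -[1+ _ ]   = refl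
coeff-X* f (+ zero)   = refl
coeff-X* f (+ suc k) = refl

coeff-0∷[] : ∀ z → coeff (0ℤ ∷ []) z ≡ 0ℤ
coeff-0∷[] z = trans (coeff-X* [] z) (coeff-[] (z - 1ℤ))

coeff-linear*ₚ : ∀ a b f z → coeff ((a ∷ b ∷ []) *ₚ f) z ≡ a * coeff f z + b * coeff f (z - 1ℤ)
coeff-linear*ₚ a b f z = begin
  coeff (map (a *_) f +ₚ (0ℤ ∷ (map (b *_) f +ₚ (0ℤ ∷ [])))) z
    ≡⟨ coeff-+ₚ (map (a *_) f) _ z ⟩
  coeff (map (a *_) f) z + coeff (0ℤ ∷ (map (b *_) f +ₚ (0ℤ ∷ []))) z
    ≡⟨ cong₂ _+_ (coeff-map (a *_) (ℤP.*-zeroʳ a) f z) (coeff-X* _ z) ⟩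
  a * coeff f z + coeff (map (b *_) f +ₚ (0ℤ ∷ [])) (z - 1ℤ)
    ≡⟨ cong (_+_ (a * coeff f z)) (coeff-+ₚ (map (b *_) f) (0ℤ ∷ []) (z - 1ℤ)) ⟩
  a * coeff f z + (coeff (map (b *_) f) (z - 1ℤ) + coeff (0ℤ ∷ []) (z - 1ℤ))
    ≡⟨ cong₂ (λ x y → a * coeff f z + (x + y)) (coeff-map (b *_) (ℤP.*-zeroʳ b) f (z - 1ℤ)) (coeff-0∷[] (z - 1ℤ)) ⟩
  a * coeff f z + (b * coeff f (z - 1ℤ) + 0ℤ)
    ≡⟨ cong (_+_ (a * coeff f z)) (ℤP.+-identityʳ _) ⟩
  a * coeff f z + b * coeff f (z - 1ℤ) ∎
  where open ≡-Reasoning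

coeff-1 : ∀ z → coeff (1ℤ ∷ []) z ≡ monomial 0 z
coeff-1 -[1+ _ ]  = refl
coeff-1 (+ zero)  = sym (trans (monomial-+ 0 0) (δ-refl 0))
coeff-1 (+ suc k) = sym (trans (monomial-+ 0 (suc k)) (δ-≢ {suc k} {0} λ ()))

coeff-X^ : ∀ n z → coeff (Xₚ ^ₚ n) z ≡ monomial n z
coeff-X^ zero    z = coeff-1 z
coeff-X^ (suc n) z = begin
  coeff (Xₚ *ₚ Xₚ ^ₚ n) z                               ≡⟨ coeff-linear*ₚ 0ℤ 1ℤ (Xₚ ^ₚ n) z ⟩
  0ℤ * coeff (Xₚ ^ₚ n) z + 1ℤ * coeff (Xₚ ^ₚ n) (z - 1ℤ) ≡⟨ shift (coeff (Xₚ ^ₚ n) z) _ ⟩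
  coeff (Xₚ ^ₚ n) (z - 1ℤ)                              ≡⟨ coeff-X^ n (z - 1ℤ) ⟩
  monomial n (z - + 1)                                  ≡⟨ monomial-- n 1 z ⟩
  monomial (n ℕ.+ 1) z                                  ≡⟨ cong (λ m → monomial m z) (ℕP.+-comm n 1) ⟩
  monomial (suc n) z                                    ∎
  where
  open ≡-Reasoning
  shift : ∀ x y → 0ℤ * x + 1ℤ * y ≡ y
  shift = solve-∀

coeff-[X-1]^ : ∀ n k → coeff ((Xₚ -ₚ constₚ 1ℤ) ^ₚ n) (+ k) ≡ sign (n ℕ.+ k) * + (n C k)
coeff-[X-1]^ zero    zero    = refl
coeff-[X-1]^ zero    (suc k) = sym (ℤP.*-zeroʳ (sign (suc k)))
coeff-[X-1]^ (suc n) k = begin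
  coeff ((Xₚ -ₚ constₚ 1ℤ) *ₚ L^n) (+ k)
    ≡⟨ coeff-linear*ₚ (- 1ℤ) 1ℤ L^n (+ k) ⟩
  - 1ℤ * coeff L^n (+ k) + 1ℤ * coeff L^n (+ k - 1ℤ)
    ≡⟨ pascal k ⟩
  sign (suc n ℕ.+ k) * + (suc n C k) ∎
  where
  open ≡-Reasoning
  L^n : Poly
  L^n = (Xₚ -ₚ constₚ 1ℤ) ^ₚ n
  pascal : ∀ k → - 1ℤ * coeff L^n (+ k) + 1ℤ * coeff L^n (+ k - 1ℤ) ≡ sign (suc n ℕ.+ k) * + (suc n C k)
  pascal zero = begin
    - 1ℤ * coeff L^n (+ 0) + 1ℤ * 0ℤ     ≡⟨ cong (λ x → - 1ℤ * x + 1ℤ * 0ℤ) (coeff-[X-1]^ n 0) ⟩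
    - 1ℤ * (sign (n ℕ.+ 0) * 1ℤ) + 1ℤ * 0ℤ ≡⟨ negate (sign (n ℕ.+ 0)) ⟩
    - sign (n ℕ.+ 0) * 1ℤ                ≡⟨ cong (_* 1ℤ) (sym (sign-suc (n ℕ.+ 0))) ⟩
    sign (suc n ℕ.+ 0) * 1ℤ              ∎
    where
    negate : ∀ s → - 1ℤ * (s * 1ℤ) + 1ℤ * 0ℤ ≡ - s * 1ℤ
    negate = solve-∀
  pascal (suc k) = begin
    - 1ℤ * coeff L^n (+ suc k) + 1ℤ * coeff L^n (+ k)
      ≡⟨ cong₂ (λ x y → - 1ℤ * x + 1ℤ * y) (coeff-[X-1]^ n (suc k)) (coeff-[X-1]^ n k) ⟩
    - 1ℤ * (sign (n ℕ.+ suc k) * + (n C suc k)) + 1ℤ * (sign (n ℕ.+ k) * + (n C k))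
      ≡⟨ cong (λ s → - 1ℤ * (s * + (n C suc k)) + 1ℤ * (sign (n ℕ.+ k) * + (n C k)))
              (trans (cong sign (ℕP.+-suc n k)) (sign-suc (n ℕ.+ k))) ⟩
    - 1ℤ * (- sign (n ℕ.+ k) * + (n C suc k)) + 1ℤ * (sign (n ℕ.+ k) * + (n C k))
      ≡⟨ collect (sign (n ℕ.+ k)) (+ (n C k)) (+ (n C suc k)) ⟩
    sign (n ℕ.+ k) * (+ (n C k) + + (n C suc k))
      ≡⟨ cong₂ (λ m c → sign m * c) (sym (ℕP.+-suc (suc n) k))
               (trans (sym (ℤP.pos-+ (n C k) (n C suc k))) (cong +_ (nCk+nC[k+1]≡[n+1]C[k+1] n k))) ⟩
    sign (suc n ℕ.+ suc k) * + (suc n C suc k) ∎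
    where
    collect : ∀ s a b → - 1ℤ * (- s * b) + 1ℤ * (s * a) ≡ s * (a + b)
    collect = solve-∀

coeff-∷-cong : ∀ a {f g} → (∀ z → coeff f z ≡ coeff g z) → ∀ z → coeff (a ∷ f) z ≡ coeff (a ∷ g) z
coeff-∷-cong a f≗g -[1+ _ ]  = refl
coeff-∷-cong a f≗g (+ zero)  = refl
coeff-∷-cong a f≗g (+ suc k) = f≗g (+ k)

coeff-strip : ∀ f z → coeff (strip f) z ≡ coeff f z
coeff-strip []      z = refl
coeff-strip (a ∷ f) z with strip f | coeff-strip f
... | []    | ih with a ℤ.≟ 0ℤ
...   | yes refl = trans (trans (coeff-[] z) (sym (coeff-0∷[] z))) (coeff-∷-cong 0ℤ ih z)
...   | no  _    = coeff-∷-cong a ih z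
coeff-strip (a ∷ f) z | _ ∷ _ | ih = coeff-∷-cong a ih z

strip-leading≢0 : ∀ f {b bs} → strip f ≡ b ∷ bs → coeff f (+ length bs) ≢ 0ℤ
strip-leading≢0 (a ∷ f) eq with strip f | strip-leading≢0 f
... | []    | _ with a ℤ.≟ 0ℤ
...   | no a≢0 = lemma eq
  where
  lemma : ∀ {b bs} → a ∷ [] ≡ b ∷ bs → coeff (a ∷ f) (+ length bs) ≢ 0ℤ
  lemma refl = a≢0
strip-leading≢0 (a ∷ f) eq | c ∷ cs | ih = lemma eq
  where
  lemma : ∀ {b bs} → a ∷ c ∷ cs ≡ b ∷ bs → coeff (a ∷ f) (+ length bs) ≢ 0ℤ
  lemma refl = ih refl

coeff-beyond : ∀ f k → length f ℕ.≤ k → coeff f (+ k) ≡ 0ℤ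
coeff-beyond []      k       _           = refl
coeff-beyond (a ∷ f) (suc k) (ℕ.s≤s f≤k) = coeff-beyond f k f≤k

record _HasDegree_ (f : Poly) (m : ℕ) : Set where
  constructor hasDegree
  field
    leading≢0 : coeff f (+ m) ≢ 0ℤ
    beyond≡0  : ∀ k → m ℕ.< k → coeff f (+ k) ≡ 0ℤ

strip-nonempty : ∀ {f m} → f HasDegree m → strip f ≢ []
strip-nonempty {f} {m} (hasDegree lead≢0 _) eq = lead≢0 (trans (sym (coeff-strip f (+ m))) (cong (λ g → coeff g (+ m)) eq))

strip-length : ∀ {f m b bs} → f HasDegree m → strip f ≡ b ∷ bs → length bs ≡ m
strip-length {f} {m} {b} {bs} (hasDegree lead≢0 beyond≡0) eq with ℕ.<-cmp (length bs) m
... | tri≈ _ bs≡m _ = bs≡m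
... | tri< bs<m _ _ = ⊥-elim (lead≢0 (begin
  coeff f (+ m)           ≡⟨ sym (coeff-strip f (+ m)) ⟩
  coeff (strip f) (+ m)   ≡⟨ cong (λ g → coeff g (+ m)) eq ⟩
  coeff (b ∷ bs) (+ m)    ≡⟨ coeff-beyond (b ∷ bs) m bs<m ⟩
  0ℤ                      ∎))
  where open ≡-Reasoning
... | tri> _ _ m<bs = ⊥-elim (strip-leading≢0 f eq (beyond≡0 (length bs) m<bs))

sylvester-cong : ∀ {ℓ} (_∼_ : ℤ → ℤ → Set ℓ) m n {f f′ g g′} →
                 (∀ z → coeff f z ∼ coeff f′ z) → (∀ z → coeff g z ∼ coeff g′ z) →
                 ∀ r c → sylvester m n f g r c ∼ sylvester m n f′ g′ r c
sylvester-cong _∼_ m n f∼f′ g∼g′ r c with toℕ r ℕ.<? n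
... | yes _ = f∼f′ ((+ m + + toℕ r) - + toℕ c)
... | no  _ = g∼g′ ((+ n + + (toℕ r ℕ.∸ n)) - + toℕ c)

Res-sylvester : ∀ {f g m n} → f HasDegree m → g HasDegree n → Res f g ≡ det (m ℕ.+ n) (sylvester m n f g)
Res-sylvester {f} {g} {m} {n} f∶m g∶n = lemma (strip f) (strip g) refl refl
  where
  lemma : ∀ F G → strip f ≡ F → strip g ≡ G → Res f g ≡ det (m ℕ.+ n) (sylvester m n f g)
  lemma []       _        f≡[] _    = ⊥-elim (strip-nonempty f∶m f≡[])
  lemma (_ ∷ _)  []       _    g≡[] = ⊥-elim (strip-nonempty g∶n g≡[])
  lemma (a ∷ as) (b ∷ bs) f≡a∷as g≡b∷bs
    rewrite f≡a∷as | g≡b∷bs | strip-length f∶m f≡a∷as | strip-length g∶n g≡b∷bs =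
      det-cong (m ℕ.+ n) (sylvester-cong _≡_ m n
        (λ z → trans (cong (λ h → coeff h z) (sym f≡a∷as)) (coeff-strip f z))
        (λ z → trans (cong (λ h → coeff h z) (sym g≡b∷bs)) (coeff-strip g z)))

-- The Sylvester determinant of X^{2p} − 1 and X^{2p} + cX^p

module _ (p : ℕ) (c : ℤ) where

  private
    D : ℕ
    D = p ℕ.+ p

  -- Rows r < 2p hold the shifts of X^{2p} − 1, rows 2p + s those of X^{2p} + cX^p.
  sylvesterModel : ℕ → ℕ → ℤ
  sylvesterModel r k with r ℕ.<? D
  ... | yes _ = δ r k - δ (D ℕ.+ r) k
  ... | no  _ = δ (r ∸ D) k + c * δ (p ℕ.+ (r ∸ D)) k

  sylvesterModel-top : ∀ {r} k → r ℕ.< D → sylvesterModel r k ≡ δ r k - δ (D ℕ.+ r) k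
  sylvesterModel-top {r} k r<D with r ℕ.<? D
  ... | yes _   = refl
  ... | no  r≮D = ⊥-elim (r≮D r<D)

  sylvesterModel-bottom : ∀ s k → sylvesterModel (D ℕ.+ s) k ≡ δ s k + c * δ (p ℕ.+ s) k
  sylvesterModel-bottom s k with D ℕ.+ s ℕ.<? D
  ... | yes D+s<D = ⊥-elim (ℕP.m+n≮m D s D+s<D)
  ... | no  _     rewrite ℕP.m+n∸m≡n D s = refl

  private
    δ-shift-p : ∀ a t → δ (p ℕ.+ a) (D ℕ.+ t) ≡ δ a (p ℕ.+ t)
    δ-shift-p a t = trans (cong (δ (p ℕ.+ a)) (ℕP.+-assoc p p t)) (δ-+ˡ p a (p ℕ.+ t))

    block₁ : ℕ → ℕ → ℤ
    block₁ s t = δ s t + c * (δ s (p ℕ.+ t) + δ (p ℕ.+ s) t)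

    cleared₁ : ℕ → ℕ → ℤ
    cleared₁ = shear D 1ℤ D sylvesterModel

    cleared₁-top : ∀ r k → r ℕ.< D → k ℕ.< D ℕ.+ D → cleared₁ r k ≡ δ r k
    cleared₁-top r k r<D k<D+D with <⊎≡+ D k
    ... | inj₁ k<D = begin
      cleared₁ r k          ≡⟨ shear-low D 1ℤ D sylvesterModel r k<D ⟩
      sylvesterModel r k    ≡⟨ sylvesterModel-top k r<D ⟩
      δ r k - δ (D ℕ.+ r) k ≡⟨ cong (λ x → δ r k - x) (δ-+< r k<D) ⟩
      δ r k - 0ℤ            ≡⟨ ℤP.+-identityʳ (δ r k) ⟩
      δ r k                 ∎
      where open ≡-Reasoning
    ... | inj₂ (t , refl) = begin
      cleared₁ r (D ℕ.+ t)
        ≡⟨ shear-high D 1ℤ D sylvesterModel r t<D ℕP.≤-refl ⟩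
      sylvesterModel r (D ℕ.+ t) + 1ℤ * sylvesterModel r t
        ≡⟨ cong₂ (λ x y → x + 1ℤ * y) (sylvesterModel-top (D ℕ.+ t) r<D) (sylvesterModel-top t r<D) ⟩
      (δ r (D ℕ.+ t) - δ (D ℕ.+ r) (D ℕ.+ t)) + 1ℤ * (δ r t - δ (D ℕ.+ r) t)
        ≡⟨ cong₂ (λ y z → (δ r (D ℕ.+ t) - y) + 1ℤ * (δ r t - z)) (δ-+ˡ D r t) (δ-+< r t<D) ⟩
      (δ r (D ℕ.+ t) - δ r t) + 1ℤ * (δ r t - 0ℤ)
        ≡⟨ telescope (δ r (D ℕ.+ t)) (δ r t) ⟩
      δ r (D ℕ.+ t) ∎
      where
      open ≡-Reasoning
      t<D : t ℕ.< D
      t<D = ℕP.+-cancelˡ-< D t D k<D+D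
      telescope : ∀ x y → (x - y) + 1ℤ * (y - 0ℤ) ≡ x
      telescope = solve-∀

    cleared₁-bottom : ∀ s t → s ℕ.< D → t ℕ.< D → cleared₁ (D ℕ.+ s) (D ℕ.+ t) ≡ block₁ s t
    cleared₁-bottom s t s<D t<D = begin
      cleared₁ (D ℕ.+ s) (D ℕ.+ t)
        ≡⟨ shear-high D 1ℤ D sylvesterModel (D ℕ.+ s) t<D ℕP.≤-refl ⟩
      sylvesterModel (D ℕ.+ s) (D ℕ.+ t) + 1ℤ * sylvesterModel (D ℕ.+ s) t
        ≡⟨ cong₂ (λ x y → x + 1ℤ * y) (sylvesterModel-bottom s (D ℕ.+ t)) (sylvesterModel-bottom s t) ⟩
      (δ s (D ℕ.+ t) + c * δ (p ℕ.+ s) (D ℕ.+ t)) + 1ℤ * (δ s t + c * δ (p ℕ.+ s) t)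
        ≡⟨ cong₂ (λ x y → (x + c * y) + 1ℤ * (δ s t + c * δ (p ℕ.+ s) t)) (δ-<+ t s<D) (δ-shift-p s t) ⟩
      (0ℤ + c * δ s (p ℕ.+ t)) + 1ℤ * (δ s t + c * δ (p ℕ.+ s) t)
        ≡⟨ regroup c (δ s t) (δ s (p ℕ.+ t)) (δ (p ℕ.+ s) t) ⟩
      block₁ s t ∎
      where
      open ≡-Reasoning
      regroup : ∀ c x y z → (0ℤ + c * y) + 1ℤ * (x + c * z) ≡ x + c * (y + z)
      regroup = solve-∀

    cleared₂ : ℕ → ℕ → ℤ
    cleared₂ = shear p (- c) p block₁

    cleared₂-top : ∀ s k → s ℕ.< p → k ℕ.< p ℕ.+ p → cleared₂ s k ≡ δ s k
    cleared₂-top s k s<p k<p+p with <⊎≡+ p k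
    ... | inj₁ k<p = begin
      cleared₂ s k
        ≡⟨ shear-low p (- c) p block₁ s k<p ⟩
      δ s k + c * (δ s (p ℕ.+ k) + δ (p ℕ.+ s) k)
        ≡⟨ cong₂ (λ x y → δ s k + c * (x + y)) (δ-<+ k s<p) (δ-+< s k<p) ⟩
      δ s k + c * (0ℤ + 0ℤ)
        ≡⟨ vanish c (δ s k) ⟩
      δ s k ∎
      where
      open ≡-Reasoning
      vanish : ∀ c x → x + c * (0ℤ + 0ℤ) ≡ x
      vanish = solve-∀
    ... | inj₂ (t , refl) = begin
      cleared₂ s (p ℕ.+ t)
        ≡⟨ shear-high p (- c) p block₁ s t<p ℕP.≤-refl ⟩
      (δ s (p ℕ.+ t) + c * (δ s (p ℕ.+ (p ℕ.+ t)) + δ (p ℕ.+ s) (p ℕ.+ t)))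
        + (- c) * (δ s t + c * (δ s (p ℕ.+ t) + δ (p ℕ.+ s) t))
        ≡⟨ cong₂ (λ x z → (x + c * (δ s (p ℕ.+ (p ℕ.+ t)) + δ (p ℕ.+ s) (p ℕ.+ t))) + (- c) * (δ s t + c * (x + z)))
                 (δ-<+ t s<p) (δ-+< s t<p) ⟩
      (0ℤ + c * (δ s (p ℕ.+ (p ℕ.+ t)) + δ (p ℕ.+ s) (p ℕ.+ t))) + (- c) * (δ s t + c * (0ℤ + 0ℤ))
        ≡⟨ cong₂ (λ x y → (0ℤ + c * (x + y)) + (- c) * (δ s t + c * (0ℤ + 0ℤ))) (δ-<+ (p ℕ.+ t) s<p) (δ-+ˡ p s t) ⟩
      (0ℤ + c * (0ℤ + δ s t)) + (- c) * (δ s t + c * (0ℤ + 0ℤ))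
        ≡⟨ cancel c (δ s t) ⟩
      0ℤ
        ≡⟨ sym (δ-<+ t s<p) ⟩
      δ s (p ℕ.+ t) ∎
      where
      open ≡-Reasoning
      t<p : t ℕ.< p
      t<p = ℕP.+-cancelˡ-< p t p k<p+p
      cancel : ∀ c x → (0ℤ + c * (0ℤ + x)) + (- c) * (x + c * (0ℤ + 0ℤ)) ≡ 0ℤ
      cancel = solve-∀

    cleared₂-bottom : ∀ s t → s ℕ.< p → t ℕ.< p → cleared₂ (p ℕ.+ s) (p ℕ.+ t) ≡ (1ℤ - c * c) * δ s t
    cleared₂-bottom s t s<p t<p = begin
      cleared₂ (p ℕ.+ s) (p ℕ.+ t)
        ≡⟨ shear-high p (- c) p block₁ (p ℕ.+ s) t<p ℕP.≤-refl ⟩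
      (δ (p ℕ.+ s) (p ℕ.+ t) + c * (δ (p ℕ.+ s) (p ℕ.+ (p ℕ.+ t)) + δ (p ℕ.+ (p ℕ.+ s)) (p ℕ.+ t)))
        + (- c) * (δ (p ℕ.+ s) t + c * (δ (p ℕ.+ s) (p ℕ.+ t) + δ (p ℕ.+ (p ℕ.+ s)) t))
        ≡⟨ cong₂ (λ x y → (x + c * (δ (p ℕ.+ s) (p ℕ.+ (p ℕ.+ t)) + δ (p ℕ.+ (p ℕ.+ s)) (p ℕ.+ t)))
                           + (- c) * (δ (p ℕ.+ s) t + c * (y + δ (p ℕ.+ (p ℕ.+ s)) t)))
                 (δ-+ˡ p s t) (δ-+ˡ p s t) ⟩
      (δ s t + c * (δ (p ℕ.+ s) (p ℕ.+ (p ℕ.+ t)) + δ (p ℕ.+ (p ℕ.+ s)) (p ℕ.+ t)))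
        + (- c) * (δ (p ℕ.+ s) t + c * (δ s t + δ (p ℕ.+ (p ℕ.+ s)) t))
        ≡⟨ cong₂ (λ x y → (δ s t + c * (x + y)) + (- c) * (δ (p ℕ.+ s) t + c * (δ s t + δ (p ℕ.+ (p ℕ.+ s)) t)))
                 (trans (δ-+ˡ p s (p ℕ.+ t)) (δ-<+ t s<p)) (trans (δ-+ˡ p (p ℕ.+ s) t) (δ-+< s t<p)) ⟩
      (δ s t + c * (0ℤ + 0ℤ)) + (- c) * (δ (p ℕ.+ s) t + c * (δ s t + δ (p ℕ.+ (p ℕ.+ s)) t))
        ≡⟨ cong₂ (λ x y → (δ s t + c * (0ℤ + 0ℤ)) + (- c) * (x + c * (δ s t + y))) (δ-+< s t<p) (δ-+< (p ℕ.+ s) t<p) ⟩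
      (δ s t + c * (0ℤ + 0ℤ)) + (- c) * (0ℤ + c * (δ s t + 0ℤ))
        ≡⟨ collect c (δ s t) ⟩
      (1ℤ - c * c) * δ s t ∎
      where
      open ≡-Reasoning
      collect : ∀ c x → (x + c * (0ℤ + 0ℤ)) + (- c) * (0ℤ + c * (x + 0ℤ)) ≡ (1ℤ - c * c) * x
      collect = solve-∀

  det-sylvesterModel : det (D ℕ.+ D) (matrix sylvesterModel) ≡ (1ℤ - c * c) ^ p
  det-sylvesterModel = begin
    det (D ℕ.+ D) (matrix sylvesterModel)
      ≡⟨ sym (det-shear D 1ℤ D sylvesterModel ℕP.≤-refl) ⟩
    det (D ℕ.+ D) (matrix cleared₁)
      ≡⟨ det-identityBlock D D cleared₁ cleared₁-top ⟩
    det D (matrix (λ s t → cleared₁ (D ℕ.+ s) (D ℕ.+ t)))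
      ≡⟨ det-congᴺ D (λ s t s<D t<D → cleared₁-bottom s t s<D t<D) ⟩
    det (p ℕ.+ p) (matrix block₁)
      ≡⟨ sym (det-shear p (- c) p block₁ ℕP.≤-refl) ⟩
    det (p ℕ.+ p) (matrix cleared₂)
      ≡⟨ det-identityBlock p p cleared₂ cleared₂-top ⟩
    det p (matrix (λ s t → cleared₂ (p ℕ.+ s) (p ℕ.+ t)))
      ≡⟨ det-congᴺ p (λ s t s<p t<p → cleared₂-bottom s t s<p t<p) ⟩
    det p (matrix (λ s t → (1ℤ - c * c) * δ s t))
      ≡⟨ det-scalar p (1ℤ - c * c) ⟩
    (1ℤ - c * c) ^ p ∎
    where open ≡-Reasoning

X²ᵖ-1 : ℕ → Poly
X²ᵖ-1 p = Xₚ ^ₚ (p ℕ.+ p) -ₚ constₚ 1ℤ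

X²ᵖ+cXᵖ : ℕ → ℤ → Poly
X²ᵖ+cXᵖ p c = Xₚ ^ₚ (p ℕ.+ p) +ₚ map (c *_) (Xₚ ^ₚ p)

coeff-X²ᵖ-1 : ∀ p z → coeff (X²ᵖ-1 p) z ≡ monomial (p ℕ.+ p) z - monomial 0 z
coeff-X²ᵖ-1 p z = begin
  coeff (Xₚ ^ₚ (p ℕ.+ p) +ₚ map -_ (constₚ 1ℤ)) z
    ≡⟨ coeff-+ₚ (Xₚ ^ₚ (p ℕ.+ p)) _ z ⟩
  coeff (Xₚ ^ₚ (p ℕ.+ p)) z + coeff (map -_ (constₚ 1ℤ)) z
    ≡⟨ cong₂ _+_ (coeff-X^ (p ℕ.+ p) z) (coeff-map -_ refl (constₚ 1ℤ) z) ⟩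
  monomial (p ℕ.+ p) z - coeff (constₚ 1ℤ) z
    ≡⟨ cong (λ x → monomial (p ℕ.+ p) z - x) (coeff-1 z) ⟩
  monomial (p ℕ.+ p) z - monomial 0 z ∎
  where open ≡-Reasoning

coeff-X²ᵖ+cXᵖ : ∀ p c z → coeff (X²ᵖ+cXᵖ p c) z ≡ monomial (p ℕ.+ p) z + c * monomial p z
coeff-X²ᵖ+cXᵖ p c z = trans (coeff-+ₚ (Xₚ ^ₚ (p ℕ.+ p)) _ z)
  (cong₂ _+_ (coeff-X^ (p ℕ.+ p) z) (trans (coeff-map (c *_) (ℤP.*-zeroʳ c) (Xₚ ^ₚ p) z) (cong (c *_) (coeff-X^ p z))))

sylvester-X²ᵖ-1-X²ᵖ+cXᵖ : ∀ p c r k →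
  sylvester (p ℕ.+ p) (p ℕ.+ p) (X²ᵖ-1 p) (X²ᵖ+cXᵖ p c) r k ≡ matrix (sylvesterModel p c) r k
sylvester-X²ᵖ-1-X²ᵖ+cXᵖ p c r k with toℕ r ℕ.<? p ℕ.+ p
... | yes _ = begin
  coeff (X²ᵖ-1 p) (+ (D ℕ.+ toℕ r) - + toℕ k)
    ≡⟨ coeff-X²ᵖ-1 p (+ (D ℕ.+ toℕ r) - + toℕ k) ⟩
  monomial D (+ (D ℕ.+ toℕ r) - + toℕ k) - monomial 0 (+ (D ℕ.+ toℕ r) - + toℕ k)
    ≡⟨ cong₂ _-_ (trans (monomial-+- D (D ℕ.+ toℕ r) (toℕ k)) (δ-+ˡ D (toℕ r) (toℕ k)))
                 (monomial-+- 0 (D ℕ.+ toℕ r) (toℕ k)) ⟩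
  δ (toℕ r) (toℕ k) - δ (D ℕ.+ toℕ r) (toℕ k) ∎
  where
  open ≡-Reasoning
  D : ℕ
  D = p ℕ.+ p
... | no _ = begin
  coeff (X²ᵖ+cXᵖ p c) (+ (D ℕ.+ s) - + toℕ k)
    ≡⟨ coeff-X²ᵖ+cXᵖ p c (+ (D ℕ.+ s) - + toℕ k) ⟩
  monomial D (+ (D ℕ.+ s) - + toℕ k) + c * monomial p (+ (D ℕ.+ s) - + toℕ k)
    ≡⟨ cong₂ (λ x y → x + c * y) (trans (monomial-+- D (D ℕ.+ s) (toℕ k)) (δ-+ˡ D s (toℕ k)))
                                 (trans (monomial-+- p (D ℕ.+ s) (toℕ k))
                                        (trans (cong (λ a → δ a (p ℕ.+ toℕ k)) (ℕP.+-assoc p p s)) (δ-+ˡ p (p ℕ.+ s) (toℕ k)))) ⟩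
  δ s (toℕ k) + c * δ (p ℕ.+ s) (toℕ k) ∎
  where
  open ≡-Reasoning
  D s : ℕ
  D = p ℕ.+ p
  s = toℕ r ∸ D

det-sylvester-X²ᵖ-1-X²ᵖ+cXᵖ : ∀ p c →
  det ((p ℕ.+ p) ℕ.+ (p ℕ.+ p)) (sylvester (p ℕ.+ p) (p ℕ.+ p) (X²ᵖ-1 p) (X²ᵖ+cXᵖ p c)) ≡ (1ℤ - c * c) ^ p
det-sylvester-X²ᵖ-1-X²ᵖ+cXᵖ p c =
  trans (det-cong _ (sylvester-X²ᵖ-1-X²ᵖ+cXᵖ p c)) (det-sylvesterModel p c)

-- Congruences

infix 4 _≡_mod_

record _≡_mod_ (x y : ℤ) (n : ℕ) : Set where
  constructor congruent
  field
    divides-difference : + n Signed.∣ x - y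


module _ {n : ℕ} where

  private
    divides-cong : ∀ {x y} → x ≡ y → + n Signed.∣ x → + n Signed.∣ y
    divides-cong refl n∣x = n∣x

  ≡⇒≡-mod : ∀ {x y} → x ≡ y → x ≡ y mod n
  ≡⇒≡-mod {x} refl = congruent (divides-cong (sym (ℤP.+-inverseʳ x)) (Signed.divides 0ℤ refl))

  ≡-mod-sym : ∀ {x y} → x ≡ y mod n → y ≡ x mod n
  ≡-mod-sym {x} {y} (congruent n∣x-y) = congruent (divides-cong (negate x y) (Signed.∣m⇒∣-m n∣x-y))
    where
    negate : ∀ x y → - (x - y) ≡ y - x
    negate = solve-∀

  ≡-mod-trans : ∀ {x y z} → x ≡ y mod n → y ≡ z mod n → x ≡ z mod n
  ≡-mod-trans {x} {y} {z} (congruent n∣x-y) (congruent n∣y-z) =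
    congruent (divides-cong (ℤP.+-minus-telescope x y z) (Signed.∣m∣n⇒∣m+n n∣x-y n∣y-z))

  +-cong-mod : ∀ {a b c d} → a ≡ b mod n → c ≡ d mod n → a + c ≡ b + d mod n
  +-cong-mod {a} {b} {c} {d} (congruent n∣a-b) (congruent n∣c-d) =
    congruent (divides-cong (regroup a b c d) (Signed.∣m∣n⇒∣m+n n∣a-b n∣c-d))
    where
    regroup : ∀ a b c d → (a - b) + (c - d) ≡ (a + c) - (b + d)
    regroup = solve-∀

  *-cong-mod : ∀ {a b c d} → a ≡ b mod n → c ≡ d mod n → a * c ≡ b * d mod n
  *-cong-mod {a} {b} {c} {d} (congruent n∣a-b) (congruent n∣c-d) =
    congruent (divides-cong (regroup a b c d) (Signed.∣m∣n⇒∣m+n (Signed.∣n⇒∣m*n a n∣c-d) (Signed.∣m⇒∣m*n d n∣a-b)))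
    where
    regroup : ∀ a b c d → a * (c - d) + (a - b) * d ≡ a * c - b * d
    regroup = solve-∀

  *-congˡ-mod : ∀ a {c d} → c ≡ d mod n → a * c ≡ a * d mod n
  *-congˡ-mod a = *-cong-mod (≡⇒≡-mod {a} refl)

  ∣⇒≡0-mod : ∀ {x} → + n Signed.∣ x → x ≡ 0ℤ mod n
  ∣⇒≡0-mod {x} n∣x = congruent (divides-cong (sym (ℤP.+-identityʳ x)) n∣x)

  ∣-respˡ-≡-mod : ∀ {x y} → x ≡ y mod n → + n Signed.∣ x → + n Signed.∣ y
  ∣-respˡ-≡-mod {x} {y} (congruent n∣x-y) n∣x = divides-cong (cancel x y) (Signed.∣m∣n⇒∣m-n n∣x n∣x-y)
    where
    cancel : ∀ x y → x - (x - y) ≡ y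
    cancel = solve-∀

  ≡-mod-isEquivalence : IsEquivalence (λ x y → x ≡ y mod n)
  ≡-mod-isEquivalence = record
    { refl  = ≡⇒≡-mod refl
    ; sym   = ≡-mod-sym
    ; trans = ≡-mod-trans
    }

≡-mod-setoid : ℕ → Setoid 0ℓ 0ℓ
≡-mod-setoid n = record { isEquivalence = ≡-mod-isEquivalence {n} }

sumFin-cong-mod : ∀ {m} n {f g : Fin n → ℤ} → (∀ i → f i ≡ g i mod m) → sumFin n f ≡ sumFin n g mod m
sumFin-cong-mod zero    f≡g = ≡⇒≡-mod refl
sumFin-cong-mod (suc n) f≡g = +-cong-mod (f≡g Fin.zero) (sumFin-cong-mod n (λ i → f≡g (Fin.suc i)))

det-cong-mod : ∀ {m} n {M N : Matrix n} → (∀ r c → M r c ≡ N r c mod m) → det n M ≡ det n N mod m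
det-cong-mod zero    M≡N = ≡⇒≡-mod refl
det-cong-mod (suc n) M≡N = sumFin-cong-mod (suc n) λ j →
  *-cong-mod (*-congˡ-mod (sign (toℕ j)) (M≡N Fin.zero j)) (det-cong-mod n (λ r c → M≡N (Fin.suc r) (punchIn j c)))

-- Reduction of R p modulo a prime p

sign-square : ∀ n → sign n * sign n ≡ 1ℤ
sign-square zero          = refl
sign-square (suc zero)    = refl
sign-square (suc (suc n)) = sign-square n

sign-double : ∀ n → sign (n ℕ.+ n) ≡ 1ℤ
sign-double zero    = refl
sign-double (suc n) = trans (cong (sign ∘ suc) (ℕP.+-suc n n)) (sign-double n)

prime≢1 : ∀ {p} → Prime p → p ≢ 1
prime≢1 p-prime = ℕ.nonTrivial⇒≢1 {{prime⇒nonTrivial p-prime}}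

prime∤! : ∀ {p m} → Prime p → m ℕ.< p → ¬ p ℕ∣.∣ m !
prime∤! {m = zero}  p-prime _   p∣1 = prime≢1 p-prime (ℕ∣.∣1⇒≡1 p∣1)
prime∤! {m = suc m} p-prime m<p p∣m! with euclidsLemma (suc m) (m !) p-prime p∣m!
... | inj₁ p∣m+1 = ℕP.<⇒≱ m<p (ℕ∣.∣⇒≤ p∣m+1)
... | inj₂ p∣m!  = prime∤! p-prime (ℕP.<-trans (ℕP.n<1+n m) m<p) p∣m!

prime∣C : ∀ {p k} → Prime p → 0 ℕ.< k → k ℕ.< p → p ℕ∣.∣ p C k
prime∣C {p} {k} p-prime 0<k k<p with euclidsLemma (p C k) (k ! ℕ.* (p ∸ k) !) p-prime p∣C*k!*[p-k]!
  where
  instance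
    k![p-k]!≢0 : ℕ.NonZero (k ! ℕ.* (p ∸ k) !)
    k![p-k]!≢0 = k ℕP.!* (p ∸ k) !≢0
    p≢0 : ℕ.NonZero p
    p≢0 = prime⇒nonZero p-prime
  n∣n! : ∀ n → .{{ℕ.NonZero n}} → n ℕ∣.∣ n !
  n∣n! (suc n) = ℕ∣.m∣m*n (n !)
  p∣C*k!*[p-k]! : p ℕ∣.∣ (p C k) ℕ.* (k ! ℕ.* (p ∸ k) !)
  p∣C*k!*[p-k]! = subst (p ℕ∣.∣_)
    (sym (trans (cong (ℕ._* (k ! ℕ.* (p ∸ k) !)) (nCk≡n!/k![n-k]! (ℕP.<⇒≤ k<p)))
                (m/n*n≡m (k![n∸k]!∣n! (ℕP.<⇒≤ k<p)))))
    (n∣n! p)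
... | inj₁ p∣C = p∣C
... | inj₂ p∣k!*[p-k]! with euclidsLemma (k !) ((p ∸ k) !) p-prime p∣k!*[p-k]!
...   | inj₁ p∣k!     = ⊥-elim (prime∤! p-prime k<p p∣k!)
...   | inj₂ p∣[p-k]! = ⊥-elim (prime∤! p-prime (ℕP.∸-monoʳ-< {p} {k} {0} 0<k (ℕP.<⇒≤ k<p)) p∣[p-k]!)

1≢0 : 1ℤ ≢ 0ℤ
1≢0 ()

[X-1]²ᵖ-1 : ℕ → Poly
[X-1]²ᵖ-1 p = (Xₚ -ₚ constₚ 1ℤ) ^ₚ (p ℕ.+ p) -ₚ constₚ 1ℤ

coeff-[X-1]²ᵖ-1 : ∀ p z → coeff ([X-1]²ᵖ-1 p) z ≡ coeff ((Xₚ -ₚ constₚ 1ℤ) ^ₚ (p ℕ.+ p)) z - monomial 0 z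
coeff-[X-1]²ᵖ-1 p z = trans (coeff-+ₚ ((Xₚ -ₚ constₚ 1ℤ) ^ₚ (p ℕ.+ p)) _ z)
  (cong (_+_ (coeff ((Xₚ -ₚ constₚ 1ℤ) ^ₚ (p ℕ.+ p)) z)) (trans (coeff-map -_ refl (constₚ 1ℤ) z) (cong -_ (coeff-1 z))))

module _ {p : ℕ} (0<p : 0 ℕ.< p) where

  private
    D : ℕ
    D = p ℕ.+ p
    0≢D : 0 ≢ D
    0≢D = ℕP.<⇒≢ (ℕP.<-≤-trans 0<p (ℕP.m≤m+n p p))

  X²ᵖ-1-degree : X²ᵖ-1 p HasDegree D
  X²ᵖ-1-degree = hasDegree (λ eq → 1≢0 (trans (sym leading≡1) eq)) beyond≡0
    where
    leading≡1 : coeff (X²ᵖ-1 p) (+ D) ≡ 1ℤ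
    leading≡1 = trans (coeff-X²ᵖ-1 p (+ D))
      (cong₂ _-_ (trans (monomial-+ D D) (δ-refl D)) (trans (monomial-+ 0 D) (δ-≢ (0≢D ∘ sym))))
    beyond≡0 : ∀ k → D ℕ.< k → coeff (X²ᵖ-1 p) (+ k) ≡ 0ℤ
    beyond≡0 k D<k = trans (coeff-X²ᵖ-1 p (+ k))
      (cong₂ _-_ (trans (monomial-+ D k) (δ-> D<k)) (trans (monomial-+ 0 k) (δ-> (ℕP.≤-<-trans ℕ.z≤n D<k))))

  [X-1]²ᵖ-1-degree : [X-1]²ᵖ-1 p HasDegree D
  [X-1]²ᵖ-1-degree = hasDegree (λ eq → 1≢0 (trans (sym leading≡1) eq)) beyond≡0
    where
    leading≡1 : coeff ([X-1]²ᵖ-1 p) (+ D) ≡ 1ℤ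
    leading≡1 = trans (coeff-[X-1]²ᵖ-1 p (+ D))
      (cong₂ _-_ (trans (coeff-[X-1]^ D D) (cong₂ (λ s c → s * + c) (sign-double D) (nCn≡1 D)))
                 (trans (monomial-+ 0 D) (δ-≢ (0≢D ∘ sym))))
    beyond≡0 : ∀ k → D ℕ.< k → coeff ([X-1]²ᵖ-1 p) (+ k) ≡ 0ℤ
    beyond≡0 k D<k = trans (coeff-[X-1]²ᵖ-1 p (+ k))
      (cong₂ _-_ (trans (coeff-[X-1]^ D k)
                        (trans (cong (λ c → sign (D ℕ.+ k) * + c) (k>n⇒nCk≡0 D<k)) (ℤP.*-zeroʳ (sign (D ℕ.+ k)))))
                 (trans (monomial-+ 0 k) (δ-> (ℕP.≤-<-trans ℕ.z≤n D<k))))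

module _ {p : ℕ} (p-prime : Prime p) where

  private
    σ : ℤ
    σ = sign p
    L : Poly
    L = Xₚ -ₚ constₚ 1ℤ
    0<p : 0 ℕ.< p
    0<p = ℕ.>-nonZero⁻¹ p {{prime⇒nonZero p-prime}}

  binomial-mod : ∀ k → sign (p ℕ.+ k) * + (p C k) ≡ δ k p + σ * δ k 0 mod p
  binomial-mod k with ℕ.<-cmp k p
  binomial-mod zero    | tri< _ _ _ = ≡⇒≡-mod (begin
    sign (p ℕ.+ 0) * 1ℤ ≡⟨ ℤP.*-identityʳ _ ⟩
    sign (p ℕ.+ 0)      ≡⟨ cong sign (ℕP.+-identityʳ p) ⟩
    σ                   ≡⟨ sym (trans (ℤP.+-identityˡ (σ * 1ℤ)) (ℤP.*-identityʳ σ)) ⟩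
    0ℤ + σ * 1ℤ         ≡⟨ sym (cong₂ (λ x y → x + σ * y) (δ-< 0<p) (δ-refl 0)) ⟩
    δ 0 p + σ * δ 0 0   ∎)
    where open ≡-Reasoning
  binomial-mod (suc k) | tri< k+1<p _ _ = ≡-mod-trans
    (∣⇒≡0-mod (Signed.∣n⇒∣m*n (sign (p ℕ.+ suc k)) (Signed.∣ᵤ⇒∣ (prime∣C p-prime ℕ.z<s k+1<p))))
    (≡⇒≡-mod (sym (trans (cong₂ (λ x y → x + σ * y) (δ-< k+1<p) (δ-≢ {suc k} {0} λ ()))
                         (cong (_+_ 0ℤ) (ℤP.*-zeroʳ σ)))))
  binomial-mod k       | tri≈ _ refl _ = ≡⇒≡-mod (begin
    sign (p ℕ.+ p) * + (p C p) ≡⟨ cong₂ (λ s c → s * + c) (sign-double p) (nCn≡1 p) ⟩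
    1ℤ                         ≡⟨ sym (cong (_+_ 1ℤ) (ℤP.*-zeroʳ σ)) ⟩
    1ℤ + σ * 0ℤ                ≡⟨ sym (cong₂ (λ x y → x + σ * y) (δ-refl p) (δ-> 0<p)) ⟩
    δ p p + σ * δ p 0          ∎)
    where open ≡-Reasoning
  binomial-mod k       | tri> _ _ p<k = ≡⇒≡-mod (begin
    sign (p ℕ.+ k) * + (p C k) ≡⟨ cong (λ c → sign (p ℕ.+ k) * + c) (k>n⇒nCk≡0 p<k) ⟩
    sign (p ℕ.+ k) * 0ℤ        ≡⟨ ℤP.*-zeroʳ (sign (p ℕ.+ k)) ⟩
    0ℤ                         ≡⟨ sym (cong (_+_ 0ℤ) (ℤP.*-zeroʳ σ)) ⟩
    0ℤ + σ * 0ℤ                ≡⟨ sym (cong₂ (λ x y → x + σ * y) (δ-> p<k) (δ-> (ℕP.<-trans 0<p p<k))) ⟩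
    δ k p + σ * δ k 0          ∎)
    where open ≡-Reasoning

  coeff-[X-1]ᵖ : ∀ z → coeff (L ^ₚ p) z ≡ monomial p z + σ * monomial 0 z mod p
  coeff-[X-1]ᵖ -[1+ _ ] = ≡⇒≡-mod (sym (cong (_+_ 0ℤ) (ℤP.*-zeroʳ σ)))
  coeff-[X-1]ᵖ (+ k)    = ≡-mod-trans (≡⇒≡-mod (coeff-[X-1]^ p k))
    (≡-mod-trans (binomial-mod k) (≡⇒≡-mod (sym (cong₂ (λ x y → x + σ * y) (monomial-+ p k) (monomial-+ 0 k)))))

  -- (X − 1)^{p+n} ≡ (X^p + σ)(X − 1)^n, read off coefficientwise.
  coeff-[X-1]^[p+n] : ∀ n z → coeff (L ^ₚ (p ℕ.+ n)) z ≡ coeff (L ^ₚ n) (z - + p) + σ * coeff (L ^ₚ n) z mod p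
  coeff-[X-1]^[p+n] zero z = begin
    coeff (L ^ₚ (p ℕ.+ 0)) z                 ≡⟨ cong (λ m → coeff (L ^ₚ m) z) (ℕP.+-identityʳ p) ⟩
    coeff (L ^ₚ p) z                         ≈⟨ coeff-[X-1]ᵖ z ⟩
    monomial p z + σ * monomial 0 z
      ≡⟨ sym (cong₂ (λ x y → x + σ * y) (trans (coeff-1 (z - + p)) (monomial-- 0 p z)) (coeff-1 z)) ⟩
    coeff (L ^ₚ 0) (z - + p) + σ * coeff (L ^ₚ 0) z ∎
    where open ≈-Reasoning (≡-mod-setoid p)
  coeff-[X-1]^[p+n] (suc n) z = begin
    coeff (L ^ₚ (p ℕ.+ suc n)) z
      ≡⟨ cong (λ m → coeff (L ^ₚ m) z) (ℕP.+-suc p n) ⟩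
    coeff (L *ₚ L ^ₚ (p ℕ.+ n)) z
      ≡⟨ coeff-linear*ₚ (- 1ℤ) 1ℤ (L ^ₚ (p ℕ.+ n)) z ⟩
    - 1ℤ * coeff (L ^ₚ (p ℕ.+ n)) z + 1ℤ * coeff (L ^ₚ (p ℕ.+ n)) (z - 1ℤ)
      ≈⟨ +-cong-mod (*-congˡ-mod (- 1ℤ) (coeff-[X-1]^[p+n] n z)) (*-congˡ-mod 1ℤ (coeff-[X-1]^[p+n] n (z - 1ℤ))) ⟩
    - 1ℤ * (c (z - + p) + σ * c z) + 1ℤ * (c (z - 1ℤ - + p) + σ * c (z - 1ℤ))
      ≡⟨ cong (λ w → - 1ℤ * (c (z - + p) + σ * c z) + 1ℤ * (c w + σ * c (z - 1ℤ))) (swap-shifts z (+ p)) ⟩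
    - 1ℤ * (c (z - + p) + σ * c z) + 1ℤ * (c (z - + p - 1ℤ) + σ * c (z - 1ℤ))
      ≡⟨ regroup σ (c (z - + p)) (c z) (c (z - + p - 1ℤ)) (c (z - 1ℤ)) ⟩
    (- 1ℤ * c (z - + p) + 1ℤ * c (z - + p - 1ℤ)) + σ * (- 1ℤ * c z + 1ℤ * c (z - 1ℤ))
      ≡⟨ sym (cong₂ (λ x y → x + σ * y) (coeff-linear*ₚ (- 1ℤ) 1ℤ (L ^ₚ n) (z - + p))
                                        (coeff-linear*ₚ (- 1ℤ) 1ℤ (L ^ₚ n) z)) ⟩
    coeff (L ^ₚ suc n) (z - + p) + σ * coeff (L ^ₚ suc n) z ∎
    where
    open ≈-Reasoning (≡-mod-setoid p)
    c : ℤ → ℤ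
    c = coeff (L ^ₚ n)
    swap-shifts : ∀ z q → z - 1ℤ - q ≡ z - q - 1ℤ
    swap-shifts = solve-∀
    regroup : ∀ s a b a′ b′ →
              - 1ℤ * (a + s * b) + 1ℤ * (a′ + s * b′) ≡ (- 1ℤ * a + 1ℤ * a′) + s * (- 1ℤ * b + 1ℤ * b′)
    regroup = solve-∀

  coeff-[X-1]²ᵖ-1-mod : ∀ z → coeff ([X-1]²ᵖ-1 p) z ≡ coeff (X²ᵖ+cXᵖ p (σ + σ)) z mod p
  coeff-[X-1]²ᵖ-1-mod z = begin
    coeff ([X-1]²ᵖ-1 p) z
      ≡⟨ coeff-[X-1]²ᵖ-1 p z ⟩
    coeff (L ^ₚ (p ℕ.+ p)) z - monomial 0 z
      ≈⟨ +-cong-mod (coeff-[X-1]^[p+n] p z) (≡⇒≡-mod refl) ⟩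
    (coeff (L ^ₚ p) (z - + p) + σ * coeff (L ^ₚ p) z) - monomial 0 z
      ≈⟨ +-cong-mod (+-cong-mod (coeff-[X-1]ᵖ (z - + p)) (*-congˡ-mod σ (coeff-[X-1]ᵖ z))) (≡⇒≡-mod refl) ⟩
    ((monomial p (z - + p) + σ * monomial 0 (z - + p)) + σ * (monomial p z + σ * monomial 0 z)) - monomial 0 z
      ≡⟨ cong₂ (λ x y → ((x + σ * y) + σ * (monomial p z + σ * monomial 0 z)) - monomial 0 z)
               (monomial-- p p z) (monomial-- 0 p z) ⟩
    ((monomial (p ℕ.+ p) z + σ * monomial p z) + σ * (monomial p z + σ * monomial 0 z)) - monomial 0 z
      ≡⟨ collect (monomial (p ℕ.+ p) z) (monomial p z) (monomial 0 z) σ (sign-square p) ⟩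
    monomial (p ℕ.+ p) z + (σ + σ) * monomial p z
      ≡⟨ sym (coeff-X²ᵖ+cXᵖ p (σ + σ) z) ⟩
    coeff (X²ᵖ+cXᵖ p (σ + σ)) z ∎
    where
    open ≈-Reasoning (≡-mod-setoid p)
    collect : ∀ a b c s → s * s ≡ 1ℤ → ((a + s * b) + s * (b + s * c)) - c ≡ a + (s + s) * b
    collect a b c s s²≡1 = trans (expand a b c s) (trans (cong (λ t → a + (s + s) * b + (t - 1ℤ) * c) s²≡1) (simplify a b c s))
      where
      expand : ∀ a b c s → ((a + s * b) + s * (b + s * c)) - c ≡ a + (s + s) * b + (s * s - 1ℤ) * c
      expand = solve-∀
      simplify : ∀ a b c s → a + (s + s) * b + (1ℤ - 1ℤ) * c ≡ a + (s + s) * b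
      simplify = solve-∀

  R≡-3^p : R p ≡ -[1+ 2 ] ^ p mod p
  R≡-3^p = begin
    R p
      ≡⟨ cong (λ m → Res (Xₚ ^ₚ m -ₚ constₚ 1ℤ) (L ^ₚ m -ₚ constₚ 1ℤ)) (cong (p ℕ.+_) (ℕP.+-identityʳ p)) ⟩
    Res (X²ᵖ-1 p) ([X-1]²ᵖ-1 p)
      ≡⟨ Res-sylvester (X²ᵖ-1-degree 0<p) ([X-1]²ᵖ-1-degree 0<p) ⟩
    det (D ℕ.+ D) (sylvester D D (X²ᵖ-1 p) ([X-1]²ᵖ-1 p))
      ≈⟨ det-cong-mod (D ℕ.+ D) (sylvester-cong (_≡_mod p) D D (λ _ → ≡⇒≡-mod refl) coeff-[X-1]²ᵖ-1-mod) ⟩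
    det (D ℕ.+ D) (sylvester D D (X²ᵖ-1 p) (X²ᵖ+cXᵖ p (σ + σ)))
      ≡⟨ det-sylvester-X²ᵖ-1-X²ᵖ+cXᵖ p (σ + σ) ⟩
    (1ℤ - (σ + σ) * (σ + σ)) ^ p
      ≡⟨ cong (_^ p) (trans (expand σ) (cong (λ t → 1ℤ - + 4 * t) (sign-square p))) ⟩
    -[1+ 2 ] ^ p ∎
    where
    open ≈-Reasoning (≡-mod-setoid p)
    D : ℕ
    D = p ℕ.+ p
    expand : ∀ s → 1ℤ - (s + s) * (s + s) ≡ 1ℤ - + 4 * (s * s)
    expand = solve-∀

∣-3^n∣≡3^n : ∀ n → ℤ.∣ -[1+ 2 ] ^ n ∣ ≡ 3 ℕ.^ n
∣-3^n∣≡3^n zero    = refl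
∣-3^n∣≡3^n (suc n) = trans (ℤP.abs-* -[1+ 2 ] (-[1+ 2 ] ^ n)) (cong (3 ℕ.*_) (∣-3^n∣≡3^n n))

prime∣^⇒∣ : ∀ {p m} n → Prime p → p ℕ∣.∣ m ℕ.^ n → p ℕ∣.∣ m
prime∣^⇒∣ zero    p-prime p∣1 = ⊥-elim (prime≢1 p-prime (ℕ∣.∣1⇒≡1 p∣1))
prime∣^⇒∣ {m = m} (suc n) p-prime p∣m*mⁿ with euclidsLemma m (m ℕ.^ n) p-prime p∣m*mⁿ
... | inj₁ p∣m  = p∣m
... | inj₂ p∣mⁿ = prime∣^⇒∣ n p-prime p∣mⁿ

prime∣3⇒≡3 : ∀ {p} → Prime p → p ℕ∣.∣ 3 → p ≡ 3
prime∣3⇒≡3 p-prime p∣3 with prime⇒irreducible (from-yes (prime? 3)) p∣3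
... | inj₁ p≡1 = ⊥-elim (prime≢1 p-prime p≡1)
... | inj₂ p≡3 = p≡3

lemma3p1 : (ℓ : ℕ) → Prime ℓ → ℓ ≢ 3 → (¬ ((+ ℓ) ∣ R ℓ)) × (R ℓ ≢ 0ℤ)
lemma3p1 ℓ ℓ-prime ℓ≢3 = ℓ∤R , λ R≡0 → ℓ∤R (subst (+ ℓ ∣_) (sym R≡0) (ℕ∣._∣0 ℓ))
  where
  ℓ∤R : ¬ (+ ℓ ∣ R ℓ)
  ℓ∤R ℓ∣R = ℓ≢3 (prime∣3⇒≡3 ℓ-prime (prime∣^⇒∣ ℓ ℓ-prime ℓ∣3^ℓ))
    where
    ℓ∣[-3]^ℓ : + ℓ Signed.∣ -[1+ 2 ] ^ ℓ
    ℓ∣[-3]^ℓ = ∣-respˡ-≡-mod (R≡-3^p ℓ-prime) (Signed.∣ᵤ⇒∣ ℓ∣R)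
    ℓ∣3^ℓ : ℓ ℕ∣.∣ 3 ℕ.^ ℓ
    ℓ∣3^ℓ = subst (ℓ ℕ∣.∣_) (∣-3^n∣≡3^n ℓ) (Signed.∣⇒∣ᵤ ℓ∣[-3]^ℓ)
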